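{- Let $|q|<1$, and let $k\ge1$ and $0\le j<k$ be integers with $j+k$ even. Then \[ \sum_{m,n\geq0}\frac{q^{(km^2-(2k-2)mn+kn^2+j(m-n))/2}(-1)^{m-n}}{(q;q)_m(q;q)_n}=\frac{(q^{(k-j)/2},q^{(k+j)/2},q^{k};q^{k})_{\infty}}{(q;q)_{\infty}}. \]
   Context: Notation: $(x;q)_n=(1-x)(1-xq)\cdots(1-xq^{n-1})$, $(x;q)_\infty=\prod_{i\ge0}(1-xq^i)$, $(x_1,\dots,x_r;q)_\infty=\prod_i(x_i;q)_\infty$. Half-integer powers of $q$ are taken with a fixed choice of $q^{1/2}$. -}

module Defs where

open import Data.Nat as ℕ using (ℕ; zero; suc; _∸_; _≤?_; _≟_)
open import Data.Nat.DivMod using (_/_)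
open import Data.Nat.Divisibility using (_∣?_)
open import Data.Integer as ℤ using (ℤ; +_; -[1+_]; ∣_∣)
open import Data.Bool using (if_then_else_)
open import Relation.Nullary using (does)

-- Formal power series in q with integer coefficients: N ↦ [q^N].
Series : Set
Series = ℕ → ℤ

sumTo : ℕ → (ℕ → ℤ) → ℤ
sumTo zero    f = + 0
sumTo (suc n) f = sumTo n f ℤ.+ f n

oneS : Series
oneS N = if does (N ≟ 0) then + 1 else + 0

monoS : ℕ → Series
monoS e N = if does (N ≟ e) then + 1 else + 0

addS subS mul : Series → Series → Series
addS f g N = f N ℤ.+ g N
subS f g N = f N ℤ.- g N
mul f g N = sumTo (suc N) (λ i → f i ℤ.* g (N ∸ i))

scaleS : ℤ → Series → Series
scaleS c f N = c ℤ.* f N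

shiftS : ℕ → Series → Series
shiftS e f N = if does (e ≤? N) then f (N ∸ e) else + 0

oneMinus : ℕ → Series
oneMinus e = subS oneS (monoS e)

-- 1/(1 - q^e) = Σ_t q^{e t}  (used only for e ≥ 1)
geom : ℕ → Series
geom e N = if does (e ∣? N) then + 1 else + 0

finProd : ℕ → (ℕ → Series) → Series
finProd zero    F = oneS
finProd (suc n) F = mul (finProd n F) (F n)

-- 1/(q;q)_m = ∏_{i=1}^{m} 1/(1-q^i)
invPoch : ℕ → Series
invPoch m = finProd m (λ i → geom (suc i))

-- (q^a;q^k)_∞ = ∏_{i≥0} (1 - q^{a+ik}), for a ≥ 1, k ≥ 1.
-- Coefficient N is that of the finite product over i ≤ N (all further
-- factors are ≡ 1 mod q^{N+1}); this is the q-adic limit of partial products.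
pochInf : ℕ → ℕ → Series
pochInf a k N = finProd (suc N) (λ i → oneMinus (a ℕ.+ i ℕ.* k)) N

-- 1/(q;q)_∞ = ∏_{i≥1} 1/(1-q^i), coefficient N via the factors i ≤ N+1.
invPochInf : Series
invPochInf N = finProd (suc N) (λ i → geom (suc i)) N

expoNum : ℕ → ℕ → ℕ → ℕ → ℤ
expoNum k j m n =
  (+ k) ℤ.* (+ m) ℤ.* (+ m)
  ℤ.- ((+ 2) ℤ.* (+ k) ℤ.- (+ 2)) ℤ.* (+ m) ℤ.* (+ n)
  ℤ.+ (+ k) ℤ.* (+ n) ℤ.* (+ n)
  ℤ.+ (+ j) ℤ.* ((+ m) ℤ.- (+ n))

-- the exponent (expoNum)/2; under the hypotheses of the theorem expoNum is a
-- non-negative even integer, so this is exactly the paper's exponent.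
expo : ℕ → ℕ → ℕ → ℕ → ℕ
expo k j m n = ∣ expoNum k j m n ∣ / 2

-- (-1)^{m-n} = (-1)^{m+n}
sgn : ℕ → ℕ → ℤ
sgn m n = -[1+ 0 ] ℤ.^ (m ℕ.+ n)

term : ℕ → ℕ → ℕ → ℕ → Series
term k j m n = scaleS (sgn m n) (shiftS (expo k j m n) (mul (invPoch m) (invPoch n)))

lhsPartial : ℕ → ℕ → ℕ → Series
lhsPartial k j M N = sumTo M (λ m → sumTo M (λ n → term k j m n N))

rhs : ℕ → ℕ → Series
rhs k j = mul (mul (mul (pochInf ((k ∸ j) / 2) k) (pochInf ((k ℕ.+ j) / 2) k))
                   (pochInf k k))
              invPochInf

{-# OPTIONS --safe #-}

-- Group the double sum along the diagonals m - n = r. Writing k = a + h and j = h - a, the summand at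
-- (m, n) = (n + r, n) is (-1)^r q^{k C(r,2) + h r} · q^{n(n+r)} / ((q;q)_n (q;q)_{n+r}), and at
-- (m, n) = (m, m + t) it is the same with a, t, m in place of h, r, n. By Durfee's identity
--   D_r(p) := Σ_n p^{n(n+r)} / ((p;p)_n (p;p)_{n+r}) = 1 / (p;p)_∞
-- at p = q, the left side is therefore θ / (q;q)_∞ with θ = Σ_{r ∈ ℤ} (-1)^r q^{k C(r,2) + h r}, and
-- the Jacobi triple product θ = (q^a, q^h, q^k; q^k)_∞ gives the right side. The triple product is
-- proved the same way: expand (q^h;q^k)_∞ and (q^a;q^k)_∞ by Euler's identity
--   (q^b;q^k)_∞ = Σ_n (-1)^n q^{k C(n,2) + b n} / (q^k;q^k)_n,
-- and the diagonals of their product sum to θ / (q^k;q^k)_∞ by Durfee's identity at p = q^k.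
-- Durfee's identity holds because D_r - D_{r+1} = -p^{r+1} (D_{r+1} - D_{r+2}), so D_r does not
-- depend on r, while D_r ≡ 1 / (p;p)_∞ modulo p^r. Power series are compared coefficientwise, so
-- every infinite sum and product reduces to a finite one.

module Submission where

open import Defs
open import Data.Nat as ℕ using (ℕ; zero; suc; _∸_; _≤_; _<_; z≤n; s≤s)
import Data.Nat.Properties as ℕP
import Data.Nat.Tactic.RingSolver as ℕ-Ring
open import Data.Integer as ℤ using (ℤ; +_; -[1+_])
import Data.Integer.Properties as ℤP
open import Data.Integer.Tactic.RingSolver using (solve-∀)
open import Relation.Binary.PropositionalEquality

module FiniteSums where

  open import Data.Integer using (_+_; _*_; -_; _-_)
  open ≡-Reasoning

  sumTo-cong< : ∀ L {f g : ℕ → ℤ} → (∀ n → n < L → f n ≡ g n) → sumTo L f ≡ sumTo L g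
  sumTo-cong< zero    e = refl
  sumTo-cong< (suc L) e = cong₂ _+_ (sumTo-cong< L (λ n n<L → e n (ℕP.m<n⇒m<1+n n<L))) (e L ℕP.≤-refl)

  sumTo-cong : ∀ L {f g : ℕ → ℤ} → (∀ n → f n ≡ g n) → sumTo L f ≡ sumTo L g
  sumTo-cong L e = sumTo-cong< L (λ n _ → e n)

  sumTo-zero : ∀ L {f : ℕ → ℤ} → (∀ n → n < L → f n ≡ + 0) → sumTo L f ≡ + 0
  sumTo-zero zero    e = refl
  sumTo-zero (suc L) e =
    cong₂ _+_ (sumTo-zero L (λ n n<L → e n (ℕP.m<n⇒m<1+n n<L))) (e L ℕP.≤-refl)

  sumTo-+ : ∀ L (f g : ℕ → ℤ) → sumTo L (λ n → f n + g n) ≡ sumTo L f + sumTo L g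
  sumTo-+ zero    f g = refl
  sumTo-+ (suc L) f g =
    trans (cong (_+ (f L + g L)) (sumTo-+ L f g)) (interchange (sumTo L f) (sumTo L g) (f L) (g L))
    where
    interchange : ∀ a b c d → (a + b) + (c + d) ≡ (a + c) + (b + d)
    interchange = solve-∀

  sumTo-neg : ∀ L (f : ℕ → ℤ) → sumTo L (λ n → - f n) ≡ - sumTo L f
  sumTo-neg zero    f = refl
  sumTo-neg (suc L) f =
    trans (cong (_+ (- f L)) (sumTo-neg L f)) (sym (ℤP.neg-distrib-+ (sumTo L f) (f L)))

  sumTo-- : ∀ L (f g : ℕ → ℤ) → sumTo L (λ n → f n - g n) ≡ sumTo L f - sumTo L g
  sumTo-- L f g = trans (sumTo-+ L f (λ n → - g n)) (cong (λ y → sumTo L f + y) (sumTo-neg L g))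

  sumTo-*ˡ : ∀ L c (f : ℕ → ℤ) → c * sumTo L f ≡ sumTo L (λ n → c * f n)
  sumTo-*ˡ zero    c f = ℤP.*-zeroʳ c
  sumTo-*ˡ (suc L) c f =
    trans (ℤP.*-distribˡ-+ c (sumTo L f) (f L)) (cong (_+ c * f L) (sumTo-*ˡ L c f))

  sumTo-*ʳ : ∀ L c (f : ℕ → ℤ) → sumTo L f * c ≡ sumTo L (λ n → f n * c)
  sumTo-*ʳ L c f =
    trans (ℤP.*-comm (sumTo L f) c) (trans (sumTo-*ˡ L c f) (sumTo-cong L (λ n → ℤP.*-comm c (f n))))

  sumTo-first : ∀ L (f : ℕ → ℤ) → sumTo (suc L) f ≡ f 0 + sumTo L (λ n → f (suc n))
  sumTo-first zero    f = trans (ℤP.+-identityˡ (f 0)) (sym (ℤP.+-identityʳ (f 0)))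
  sumTo-first (suc L) f = trans (cong (_+ f (suc L)) (sumTo-first L f)) (ℤP.+-assoc (f 0) _ _)

  sumTo-swap : ∀ A B (f : ℕ → ℕ → ℤ) →
    sumTo A (λ m → sumTo B (f m)) ≡ sumTo B (λ n → sumTo A (λ m → f m n))
  sumTo-swap zero    B f = sym (sumTo-zero B (λ _ _ → refl))
  sumTo-swap (suc A) B f =
    trans (cong (_+ sumTo B (f A)) (sumTo-swap A B f))
          (sym (sumTo-+ B (λ n → sumTo A (λ m → f m n)) (f A)))

  sumTo-reverse : ∀ N (f : ℕ → ℤ) → sumTo (suc N) f ≡ sumTo (suc N) (λ i → f (N ∸ i))
  sumTo-reverse zero    f = refl
  sumTo-reverse (suc N) f =
    trans (cong (_+ f (suc N)) (sumTo-reverse N f))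
          (trans (ℤP.+-comm _ (f (suc N))) (sym (sumTo-first (suc N) (λ i → f (suc N ∸ i)))))

  sumTo-split : ∀ B C (f : ℕ → ℤ) → sumTo (B ℕ.+ C) f ≡ sumTo B f + sumTo C (λ s → f (B ℕ.+ s))
  sumTo-split B zero    f = trans (cong (λ x → sumTo x f) (ℕP.+-identityʳ B)) (sym (ℤP.+-identityʳ _))
  sumTo-split B (suc C) f rewrite ℕP.+-suc B C =
    trans (cong (_+ f (B ℕ.+ C)) (sumTo-split B C f)) (ℤP.+-assoc (sumTo B f) _ _)

  sumTo-vanishing : ∀ B L (f : ℕ → ℤ) → (∀ n → B ≤ n → f n ≡ + 0) → B ≤ L → sumTo L f ≡ sumTo B f
  sumTo-vanishing B L f vanish B≤L = begin
    sumTo L f                                      ≡⟨ cong (λ x → sumTo x f) (sym (ℕP.m+[n∸m]≡n B≤L)) ⟩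
    sumTo (B ℕ.+ (L ∸ B)) f                        ≡⟨ sumTo-split B (L ∸ B) f ⟩
    sumTo B f + sumTo (L ∸ B) (λ s → f (B ℕ.+ s))
      ≡⟨ cong (λ y → sumTo B f + y) (sumTo-zero (L ∸ B) (λ s _ → vanish _ (ℕP.m≤m+n B s))) ⟩
    sumTo B f + + 0                                ≡⟨ ℤP.+-identityʳ _ ⟩
    sumTo B f                                      ∎

  sumTo-triangle : ∀ M (T : ℕ → ℕ → ℤ) →
    sumTo M (λ i → sumTo (suc i) (λ a → T a i)) ≡ sumTo M (λ a → sumTo (M ∸ a) (λ b → T a (a ℕ.+ b)))
  sumTo-triangle zero    T = refl
  sumTo-triangle (suc M) T = begin
    sumTo M (λ i → sumTo (suc i) (λ a → T a i)) + sumTo (suc M) (λ a → T a M)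
      ≡⟨ cong (_+ sumTo (suc M) (λ a → T a M)) (sumTo-triangle M T) ⟩
    sumTo M R + (sumTo M (λ a → T a M) + T M M)
      ≡⟨ sym (ℤP.+-assoc (sumTo M R) _ _) ⟩
    sumTo M R + sumTo M (λ a → T a M) + T M M
      ≡⟨ cong₂ _+_ (sym (sumTo-+ M R (λ a → T a M))) (sym lastRow) ⟩
    sumTo M (λ a → R a + T a M) + sumTo (suc M ∸ M) (λ b → T M (M ℕ.+ b))
      ≡⟨ cong (_+ sumTo (suc M ∸ M) (λ b → T M (M ℕ.+ b))) (sym (sumTo-cong< M rowGrows)) ⟩
    sumTo M (λ a → sumTo (suc M ∸ a) (λ b → T a (a ℕ.+ b))) + sumTo (suc M ∸ M) (λ b → T M (M ℕ.+ b))
      ∎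
    where
    R : ℕ → ℤ
    R a = sumTo (M ∸ a) (λ b → T a (a ℕ.+ b))
    rowGrows : ∀ a → a < M → sumTo (suc M ∸ a) (λ b → T a (a ℕ.+ b)) ≡ R a + T a M
    rowGrows a a<M rewrite ℕP.+-∸-assoc 1 (ℕP.<⇒≤ a<M) =
      cong (λ x → R a + T a x) (ℕP.m+[n∸m]≡n (ℕP.<⇒≤ a<M))
    lastRow : sumTo (suc M ∸ M) (λ b → T M (M ℕ.+ b)) ≡ T M M
    lastRow rewrite ℕP.m+n∸n≡m 1 M = trans (ℤP.+-identityˡ _) (cong (T M) (ℕP.+-identityʳ M))

  sumTo-diagonals : ∀ B A (f : ℕ → ℕ → ℤ) →
    (∀ m n → B ≤ m → f m n ≡ + 0) → (∀ m n → B ≤ n → f m n ≡ + 0) → B ≤ A →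
    sumTo A (λ m → sumTo A (f m))
      ≡ sumTo A (λ r → sumTo A (λ n → f (n ℕ.+ r) n)) + sumTo A (λ s → sumTo A (λ m → f m (suc m ℕ.+ s)))
  sumTo-diagonals B A f vanishˡ vanishʳ B≤A = begin
    sumTo A (λ m → sumTo A (f m))
      ≡⟨ sumTo-cong< A splitRow ⟩
    sumTo A (λ m → sumTo (suc m) (f m) + sumTo (A ∸ suc m) (λ s → f m (suc m ℕ.+ s)))
      ≡⟨ sumTo-+ A _ _ ⟩
    sumTo A (λ m → sumTo (suc m) (f m)) + sumTo A (λ m → sumTo (A ∸ suc m) (λ s → f m (suc m ℕ.+ s)))
      ≡⟨ cong₂ _+_ lower upper ⟩
    sumTo A (λ r → sumTo A (λ n → f (n ℕ.+ r) n)) + sumTo A (λ s → sumTo A (λ m → f m (suc m ℕ.+ s)))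
      ∎
    where
    splitRow : ∀ m → m < A →
      sumTo A (f m) ≡ sumTo (suc m) (f m) + sumTo (A ∸ suc m) (λ s → f m (suc m ℕ.+ s))
    splitRow m m<A =
      trans (cong (λ x → sumTo x (f m)) (sym (ℕP.m+[n∸m]≡n m<A))) (sumTo-split (suc m) (A ∸ suc m) (f m))
    pastA : ∀ c {y} → A ∸ c ≤ y → B ≤ c ℕ.+ y
    pastA c le = ℕP.≤-trans B≤A (ℕP.≤-trans (ℕP.m≤n+m∸n A c) (ℕP.+-monoʳ-≤ c le))
    lower : sumTo A (λ m → sumTo (suc m) (f m)) ≡ sumTo A (λ r → sumTo A (λ n → f (n ℕ.+ r) n))
    lower = begin
      sumTo A (λ m → sumTo (suc m) (f m))
        ≡⟨ sumTo-triangle A (λ a i → f i a) ⟩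
      sumTo A (λ n → sumTo (A ∸ n) (λ r → f (n ℕ.+ r) n))
        ≡⟨ sumTo-cong A (λ n → sym (sumTo-vanishing (A ∸ n) A _
             (λ r le → vanishˡ _ n (pastA n le)) (ℕP.m∸n≤m A n))) ⟩
      sumTo A (λ n → sumTo A (λ r → f (n ℕ.+ r) n))
        ≡⟨ sumTo-swap A A (λ n r → f (n ℕ.+ r) n) ⟩
      sumTo A (λ r → sumTo A (λ n → f (n ℕ.+ r) n))
        ∎
    upper : sumTo A (λ m → sumTo (A ∸ suc m) (λ s → f m (suc m ℕ.+ s)))
          ≡ sumTo A (λ s → sumTo A (λ m → f m (suc m ℕ.+ s)))
    upper = trans
      (sumTo-cong A (λ m → sym (sumTo-vanishing (A ∸ suc m) A _
         (λ s le → vanishʳ m _ (pastA (suc m) le)) (ℕP.m∸n≤m A (suc m)))))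
      (sumTo-swap A A (λ m s → f m (suc m ℕ.+ s)))

module PowerSeries where

  open import Data.Integer using (_+_; _*_; -_; _-_)
  open import Algebra.Properties.Ring ℤP.+-*-ring using (x[y-z]≈xy-xz)
  open import Data.Nat using (_≤?_; _≟_)
  open import Data.Nat.Divisibility using (_∣_; _∣?_; _∣0; ∣-refl; ∣⇒≤; ∣m+n∣m⇒∣n; ∣m∸n∣n⇒∣m)
  open import Relation.Nullary using (¬_; yes; no)
  open import Relation.Nullary.Negation using (contradiction)
  open import Relation.Nullary.Decidable using (dec-true; dec-false)
  import Relation.Binary.Reasoning.Setoid
  open FiniteSums

  module ≗-Reasoning = Relation.Binary.Reasoning.Setoid (ℕ →-setoid ℤ)

  infix 4 _≗[_]_
  _≗[_]_ : Series → ℕ → Series → Set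
  f ≗[ N ] g = ∀ i → i ≤ N → f i ≡ g i

  ≗⇒≗[] : ∀ {f g} N → f ≗ g → f ≗[ N ] g
  ≗⇒≗[] N e i _ = e i

  ≗[]-trans : ∀ {N f g h} → f ≗[ N ] g → g ≗[ N ] h → f ≗[ N ] h
  ≗[]-trans e d i i≤N = trans (e i i≤N) (d i i≤N)

  ≗[]-sym : ∀ {N f g} → f ≗[ N ] g → g ≗[ N ] f
  ≗[]-sym e i i≤N = sym (e i i≤N)

  shiftS-≤ : ∀ e f {N} → e ≤ N → shiftS e f N ≡ f (N ∸ e)
  shiftS-≤ e f {N} e≤N rewrite dec-true (e ≤? N) e≤N = refl

  shiftS-≰ : ∀ e f {N} → ¬ e ≤ N → shiftS e f N ≡ + 0
  shiftS-≰ e f {N} e≰N rewrite dec-false (e ≤? N) e≰N = refl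

  monoS-refl : ∀ e → monoS e e ≡ + 1
  monoS-refl e rewrite dec-true (e ≟ e) refl = refl

  monoS-≢ : ∀ e {i} → i ≢ e → monoS e i ≡ + 0
  monoS-≢ e {i} i≢e rewrite dec-false (i ≟ e) i≢e = refl

  mul-cong : ∀ {f f′ g g′} → f ≗ f′ → g ≗ g′ → mul f g ≗ mul f′ g′
  mul-cong e d N = sumTo-cong (suc N) (λ i → cong₂ _*_ (e i) (d (N ∸ i)))

  mul-congˡ : ∀ f {g g′} → g ≗ g′ → mul f g ≗ mul f g′
  mul-congˡ f = mul-cong {f} {f} (λ _ → refl)

  mul-congʳ : ∀ g {f f′} → f ≗ f′ → mul f g ≗ mul f′ g
  mul-congʳ g e = mul-cong {g = g} {g′ = g} e (λ _ → refl)

  mul-cong[] : ∀ {N f f′ g g′} → f ≗[ N ] f′ → g ≗[ N ] g′ → mul f g ≗[ N ] mul f′ g′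
  mul-cong[] e d M M≤N = sumTo-cong< (suc M) (λ i i≤M →
    cong₂ _*_ (e i (ℕP.≤-trans (ℕP.≤-pred i≤M) M≤N)) (d (M ∸ i) (ℕP.≤-trans (ℕP.m∸n≤m M i) M≤N)))

  subS-cong : ∀ {f f′ g g′} → f ≗ f′ → g ≗ g′ → subS f g ≗ subS f′ g′
  subS-cong e d i = cong₂ _-_ (e i) (d i)

  scaleS-cong : ∀ c {f f′} → f ≗ f′ → scaleS c f ≗ scaleS c f′
  scaleS-cong c e i = cong (c *_) (e i)

  shiftS-cong[] : ∀ {N} e {f f′} → f ≗[ N ] f′ → shiftS e f ≗[ N ] shiftS e f′
  shiftS-cong[] e {f} {f′} d i i≤N with e ≤? i
  ... | yes e≤i = trans (shiftS-≤ e f e≤i)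
                    (trans (d (i ∸ e) (ℕP.≤-trans (ℕP.m∸n≤m i e) i≤N)) (sym (shiftS-≤ e f′ e≤i)))
  ... | no e≰i  = trans (shiftS-≰ e f e≰i) (sym (shiftS-≰ e f′ e≰i))

  shiftS-cong : ∀ e {f f′} → f ≗ f′ → shiftS e f ≗ shiftS e f′
  shiftS-cong e d i = shiftS-cong[] e (≗⇒≗[] i d) i ℕP.≤-refl

  shiftS-≡ : ∀ {a b} f → a ≡ b → shiftS a f ≗ shiftS b f
  shiftS-≡ f refl _ = refl

  scaleS-≡ : ∀ {c c′} f → c ≡ c′ → scaleS c f ≗ scaleS c′ f
  scaleS-≡ f refl _ = refl

  mul-comm : ∀ f g → mul f g ≗ mul g f
  mul-comm f g N = trans (sumTo-reverse N _) (sumTo-cong< (suc N) (λ i i≤N →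
    trans (cong (λ x → f (N ∸ i) * g x) (ℕP.m∸[m∸n]≡n (ℕP.≤-pred i≤N))) (ℤP.*-comm (f (N ∸ i)) (g i))))

  mul-assoc : ∀ f g h → mul (mul f g) h ≗ mul f (mul g h)
  mul-assoc f g h M = begin
    sumTo (suc M) (λ i → sumTo (suc i) (λ a → f a * g (i ∸ a)) * h (M ∸ i))
      ≡⟨ sumTo-cong (suc M) (λ i → sumTo-*ʳ (suc i) (h (M ∸ i)) (λ a → f a * g (i ∸ a))) ⟩
    sumTo (suc M) (λ i → sumTo (suc i) (λ a → f a * g (i ∸ a) * h (M ∸ i)))
      ≡⟨ sumTo-triangle (suc M) (λ a i → f a * g (i ∸ a) * h (M ∸ i)) ⟩
    sumTo (suc M) (λ a → sumTo (suc M ∸ a) (λ b → f a * g (a ℕ.+ b ∸ a) * h (M ∸ (a ℕ.+ b))))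
      ≡⟨ sumTo-cong< (suc M) row ⟩
    sumTo (suc M) (λ a → f a * sumTo (suc (M ∸ a)) (λ b → g b * h (M ∸ a ∸ b)))
      ∎
    where
    open ≡-Reasoning
    row : ∀ a → a < suc M → sumTo (suc M ∸ a) (λ b → f a * g (a ℕ.+ b ∸ a) * h (M ∸ (a ℕ.+ b)))
                           ≡ f a * sumTo (suc (M ∸ a)) (λ b → g b * h (M ∸ a ∸ b))
    row a a≤M rewrite ℕP.+-∸-assoc 1 (ℕP.≤-pred a≤M) =
      trans (sumTo-cong (suc (M ∸ a)) (λ b →
               trans (cong₂ (λ x y → f a * g x * h y) (ℕP.m+n∸m≡n a b) (sym (ℕP.∸-+-assoc M a b)))
                     (ℤP.*-assoc (f a) (g b) (h (M ∸ a ∸ b)))))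
            (sym (sumTo-*ˡ (suc (M ∸ a)) (f a) (λ b → g b * h (M ∸ a ∸ b))))

  mul-interchange : ∀ a b c d → mul (mul a b) (mul c d) ≗ mul (mul a c) (mul b d)
  mul-interchange a b c d = begin
    mul (mul a b) (mul c d)   ≈⟨ mul-assoc a b (mul c d) ⟩
    mul a (mul b (mul c d))   ≈⟨ mul-congˡ a (λ i → sym (mul-assoc b c d i)) ⟩
    mul a (mul (mul b c) d)   ≈⟨ mul-congˡ a (mul-congʳ d (mul-comm b c)) ⟩
    mul a (mul (mul c b) d)   ≈⟨ mul-congˡ a (mul-assoc c b d) ⟩
    mul a (mul c (mul b d))   ≈⟨ mul-assoc a c (mul b d) ⟨
    mul (mul a c) (mul b d)   ∎
    where open ≗-Reasoning

  mul-swapʳ : ∀ a b c → mul (mul a b) c ≗ mul (mul a c) b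
  mul-swapʳ a b c = begin
    mul (mul a b) c   ≈⟨ mul-assoc a b c ⟩
    mul a (mul b c)   ≈⟨ mul-congˡ a (mul-comm b c) ⟩
    mul a (mul c b)   ≈⟨ mul-assoc a c b ⟨
    mul (mul a c) b   ∎
    where open ≗-Reasoning

  mul-subS : ∀ f g h → mul f (subS g h) ≗ subS (mul f g) (mul f h)
  mul-subS f g h N =
    trans (sumTo-cong (suc N) (λ i → x[y-z]≈xy-xz (f i) (g (N ∸ i)) (h (N ∸ i)))) (sumTo-- (suc N) _ _)

  mul-addSˡ : ∀ f g h → mul (addS f g) h ≗ addS (mul f h) (mul g h)
  mul-addSˡ f g h N =
    trans (sumTo-cong (suc N) (λ i → ℤP.*-distribʳ-+ (h (N ∸ i)) (f i) (g i))) (sumTo-+ (suc N) _ _)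

  mul-scaleSˡ : ∀ c f g → mul (scaleS c f) g ≗ scaleS c (mul f g)
  mul-scaleSˡ c f g N =
    trans (sumTo-cong (suc N) (λ i → ℤP.*-assoc c (f i) (g (N ∸ i)))) (sym (sumTo-*ˡ (suc N) c _))

  mul-scaleSʳ : ∀ c f g → mul f (scaleS c g) ≗ scaleS c (mul f g)
  mul-scaleSʳ c f g N = trans (mul-comm f (scaleS c g) N) (trans (mul-scaleSˡ c g f N) (cong (c *_) (mul-comm g f N)))

  mul-identityˡ : ∀ f → mul oneS f ≗ f
  mul-identityˡ f N = begin
    sumTo (suc N) (λ i → oneS i * f (N ∸ i))
      ≡⟨ sumTo-first N _ ⟩
    + 1 * f N + sumTo N (λ i → oneS (suc i) * f (N ∸ suc i))
      ≡⟨ cong (λ y → + 1 * f N + y) (sumTo-zero N (λ _ _ → refl)) ⟩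
    + 1 * f N + + 0
      ≡⟨ trans (ℤP.+-identityʳ _) (ℤP.*-identityˡ (f N)) ⟩
    f N
      ∎
    where open ≡-Reasoning

  mul-identityʳ : ∀ f → mul f oneS ≗ f
  mul-identityʳ f N = trans (mul-comm f oneS N) (mul-identityˡ f N)

  sumTo-monoS-≤ : ∀ L e (g : ℕ → ℤ) → L ≤ e → sumTo L (λ i → monoS e i * g i) ≡ + 0
  sumTo-monoS-≤ L e g L≤e =
    sumTo-zero L (λ i i<L → cong (_* g i) (monoS-≢ e (λ i≡e → ℕP.<-irrefl i≡e (ℕP.<-≤-trans i<L L≤e))))

  sumTo-monoS-> : ∀ L e (g : ℕ → ℤ) → e < L → sumTo L (λ i → monoS e i * g i) ≡ g e
  sumTo-monoS-> L e g e<L = begin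
    sumTo L (λ i → monoS e i * g i)
      ≡⟨ sumTo-vanishing (suc e) L _ (λ i e<i → cong (_* g i) (monoS-≢ e (λ i≡e → ℕP.<-irrefl (sym i≡e) e<i))) e<L ⟩
    sumTo e (λ i → monoS e i * g i) + monoS e e * g e
      ≡⟨ cong₂ _+_ (sumTo-monoS-≤ e e g ℕP.≤-refl) (cong (_* g e) (monoS-refl e)) ⟩
    + 0 + + 1 * g e
      ≡⟨ trans (ℤP.+-identityˡ _) (ℤP.*-identityˡ (g e)) ⟩
    g e
      ∎
    where open ≡-Reasoning

  mul-monoSˡ : ∀ e f → mul (monoS e) f ≗ shiftS e f
  mul-monoSˡ e f N with e ≤? N
  ... | yes e≤N = trans (sumTo-monoS-> (suc N) e _ (s≤s e≤N)) (sym (shiftS-≤ e f e≤N))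
  ... | no e≰N  = trans (sumTo-monoS-≤ (suc N) e _ (ℕP.≰⇒> e≰N)) (sym (shiftS-≰ e f e≰N))

  shiftS-zero : ∀ f → shiftS 0 f ≗ f
  shiftS-zero f N = shiftS-≤ 0 f z≤n

  shiftS-shiftS : ∀ a b f → shiftS a (shiftS b f) ≗ shiftS (a ℕ.+ b) f
  shiftS-shiftS a b f N with a ≤? N
  ... | no a≰N = trans (shiftS-≰ a (shiftS b f) a≰N)
                       (sym (shiftS-≰ (a ℕ.+ b) f (λ a+b≤N → a≰N (ℕP.m+n≤o⇒m≤o a a+b≤N))))
  ... | yes a≤N with b ≤? N ∸ a
  ...   | yes b≤N∸a = begin
    shiftS a (shiftS b f) N  ≡⟨ shiftS-≤ a (shiftS b f) a≤N ⟩
    shiftS b f (N ∸ a)       ≡⟨ shiftS-≤ b f b≤N∸a ⟩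
    f (N ∸ a ∸ b)            ≡⟨ cong f (ℕP.∸-+-assoc N a b) ⟩
    f (N ∸ (a ℕ.+ b))        ≡⟨ sym (shiftS-≤ (a ℕ.+ b) f a+b≤N) ⟩
    shiftS (a ℕ.+ b) f N     ∎
    where
    open ≡-Reasoning
    a+b≤N : a ℕ.+ b ≤ N
    a+b≤N = subst (_≤ N) (ℕP.+-comm b a) (ℕP.m≤o∸n⇒m+n≤o b a≤N b≤N∸a)
  ...   | no b≰N∸a = trans (shiftS-≤ a (shiftS b f) a≤N) (trans (shiftS-≰ b f b≰N∸a)
                       (sym (shiftS-≰ (a ℕ.+ b) f (λ a+b≤N → b≰N∸a (ℕP.m+n≤o⇒m≤o∸n b (subst (_≤ N) (ℕP.+-comm a b) a+b≤N))))))

  mul-shiftSˡ : ∀ e f g → mul (shiftS e f) g ≗ shiftS e (mul f g)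
  mul-shiftSˡ e f g = begin
    mul (shiftS e f) g          ≈⟨ mul-congʳ g (λ i → sym (mul-monoSˡ e f i)) ⟩
    mul (mul (monoS e) f) g     ≈⟨ mul-assoc (monoS e) f g ⟩
    mul (monoS e) (mul f g)     ≈⟨ mul-monoSˡ e (mul f g) ⟩
    shiftS e (mul f g)          ∎
    where open ≗-Reasoning

  mul-shiftSʳ : ∀ e f g → mul f (shiftS e g) ≗ shiftS e (mul f g)
  mul-shiftSʳ e f g = begin
    mul f (shiftS e g)   ≈⟨ mul-comm f (shiftS e g) ⟩
    mul (shiftS e g) f   ≈⟨ mul-shiftSˡ e g f ⟩
    shiftS e (mul g f)   ≈⟨ shiftS-cong e (mul-comm g f) ⟩
    shiftS e (mul f g)   ∎
    where open ≗-Reasoning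

  shiftS-subS : ∀ e f g → shiftS e (subS f g) ≗ subS (shiftS e f) (shiftS e g)
  shiftS-subS e f g = begin
    shiftS e (subS f g)                          ≈⟨ mul-monoSˡ e (subS f g) ⟨
    mul (monoS e) (subS f g)                     ≈⟨ mul-subS (monoS e) f g ⟩
    subS (mul (monoS e) f) (mul (monoS e) g)     ≈⟨ subS-cong (mul-monoSˡ e f) (mul-monoSˡ e g) ⟩
    subS (shiftS e f) (shiftS e g)               ∎
    where open ≗-Reasoning

  shiftS-scaleS : ∀ e c f → shiftS e (scaleS c f) ≗ scaleS c (shiftS e f)
  shiftS-scaleS e c f = begin
    shiftS e (scaleS c f)          ≈⟨ mul-monoSˡ e (scaleS c f) ⟨
    mul (monoS e) (scaleS c f)     ≈⟨ mul-scaleSʳ c (monoS e) f ⟩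
    scaleS c (mul (monoS e) f)     ≈⟨ scaleS-cong c (mul-monoSˡ e f) ⟩
    scaleS c (shiftS e f)          ∎
    where open ≗-Reasoning

  scaleS-scaleS : ∀ a b f → scaleS a (scaleS b f) ≗ scaleS (a * b) f
  scaleS-scaleS a b f i = sym (ℤP.*-assoc a b (f i))

  scaleS-subS : ∀ c f g → scaleS c (subS f g) ≗ subS (scaleS c f) (scaleS c g)
  scaleS-subS c f g i = x[y-z]≈xy-xz c (f i) (g i)

  mul-scaleS-shiftS : ∀ c₁ x₁ f c₂ x₂ g →
    mul (scaleS c₁ (shiftS x₁ f)) (scaleS c₂ (shiftS x₂ g)) ≗ scaleS (c₁ * c₂) (shiftS (x₁ ℕ.+ x₂) (mul f g))
  mul-scaleS-shiftS c₁ x₁ f c₂ x₂ g = begin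
    mul (scaleS c₁ (shiftS x₁ f)) (scaleS c₂ (shiftS x₂ g))
      ≈⟨ mul-scaleSˡ c₁ (shiftS x₁ f) (scaleS c₂ (shiftS x₂ g)) ⟩
    scaleS c₁ (mul (shiftS x₁ f) (scaleS c₂ (shiftS x₂ g)))
      ≈⟨ scaleS-cong c₁ (mul-scaleSʳ c₂ (shiftS x₁ f) (shiftS x₂ g)) ⟩
    scaleS c₁ (scaleS c₂ (mul (shiftS x₁ f) (shiftS x₂ g)))
      ≈⟨ scaleS-scaleS c₁ c₂ _ ⟩
    scaleS (c₁ * c₂) (mul (shiftS x₁ f) (shiftS x₂ g))
      ≈⟨ scaleS-cong (c₁ * c₂) (λ i → trans (mul-shiftSˡ x₁ f (shiftS x₂ g) i)
           (trans (shiftS-cong x₁ (mul-shiftSʳ x₂ f g) i) (shiftS-shiftS x₁ x₂ (mul f g) i))) ⟩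
    scaleS (c₁ * c₂) (shiftS (x₁ ℕ.+ x₂) (mul f g))
      ∎
    where open ≗-Reasoning

  mul-oneMinusʳ : ∀ e f → mul f (oneMinus e) ≗ subS f (shiftS e f)
  mul-oneMinusʳ e f = begin
    mul f (subS oneS (monoS e))        ≈⟨ mul-subS f oneS (monoS e) ⟩
    subS (mul f oneS) (mul f (monoS e))
      ≈⟨ subS-cong (mul-identityʳ f) (λ i → trans (mul-comm f (monoS e) i) (mul-monoSˡ e f i)) ⟩
    subS f (shiftS e f)                ∎
    where open ≗-Reasoning

  geom-∸ : ∀ e {N} → e ≤ N → geom e (N ∸ e) ≡ geom e N
  geom-∸ e {N} e≤N with e ∣? N | e ∣? (N ∸ e)
  ... | yes _   | yes _   = refl
  ... | no _    | no _    = refl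
  ... | yes e∣N | no e∤N-e =
    contradiction (∣m+n∣m⇒∣n (subst (e ∣_) (sym (ℕP.m+[n∸m]≡n e≤N)) e∣N) ∣-refl) e∤N-e
  ... | no e∤N  | yes e∣N-e = contradiction (∣m∸n∣n⇒∣m e e≤N e∣N-e ∣-refl) e∤N

  geom-< : ∀ e {N} → N < e → geom e N ≡ oneS N
  geom-< e {zero}  _   with e ∣? 0
  ... | yes _  = refl
  ... | no e∤0 = contradiction (e ∣0) e∤0
  geom-< e {suc N} N<e with e ∣? suc N
  ... | yes e∣N = contradiction (∣⇒≤ e∣N) (ℕP.<⇒≱ N<e)
  ... | no _    = refl

  geom-oneMinus : ∀ e → 1 ≤ e → mul (geom e) (oneMinus e) ≗ oneS
  geom-oneMinus e 1≤e N = trans (mul-oneMinusʳ e (geom e) N) (telescope N)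
    where
    telescope : ∀ N → geom e N - shiftS e (geom e) N ≡ oneS N
    telescope N with e ≤? N
    ... | yes e≤N = begin
      geom e N - shiftS e (geom e) N   ≡⟨ cong (λ x → geom e N - x) (trans (shiftS-≤ e (geom e) e≤N) (geom-∸ e e≤N)) ⟩
      geom e N - geom e N              ≡⟨ ℤP.+-inverseʳ (geom e N) ⟩
      + 0                              ≡⟨ positive (ℕP.<-≤-trans 1≤e e≤N) ⟨
      oneS N                           ∎
      where
      open ≡-Reasoning
      positive : ∀ {N} → 0 < N → oneS N ≡ + 0
      positive {suc N} _ = refl
    ... | no e≰N = trans (cong (λ x → geom e N - x) (shiftS-≰ e (geom e) e≰N))
                         (trans (ℤP.+-identityʳ _) (geom-< e (ℕP.≰⇒> e≰N)))

  geom-≗[]-oneS : ∀ {N} e → N < e → geom e ≗[ N ] oneS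
  geom-≗[]-oneS e N<e i i≤N = geom-< e (ℕP.≤-<-trans i≤N N<e)

  oneMinus-≗[]-oneS : ∀ {N} e → N < e → oneMinus e ≗[ N ] oneS
  oneMinus-≗[]-oneS e N<e i i≤N =
    trans (cong (λ x → oneS i - x) (monoS-≢ e (λ i≡e → ℕP.<-irrefl i≡e (ℕP.≤-<-trans i≤N N<e)))) (ℤP.+-identityʳ _)

  Ord≥ : ℕ → Series → Set
  Ord≥ t f = ∀ i → i < t → f i ≡ + 0

  Ord≥-weaken : ∀ {s t f} → s ≤ t → Ord≥ t f → Ord≥ s f
  Ord≥-weaken s≤t ord i i<s = ord i (ℕP.<-≤-trans i<s s≤t)

  Ord≥-mulˡ : ∀ {t} f g → Ord≥ t f → Ord≥ t (mul f g)
  Ord≥-mulˡ f g ord i i<t =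
    sumTo-zero (suc i) (λ a a≤i → cong (_* g (i ∸ a)) (ord a (ℕP.≤-<-trans (ℕP.≤-pred a≤i) i<t)))

  Ord≥-mulʳ : ∀ {t} f g → Ord≥ t g → Ord≥ t (mul f g)
  Ord≥-mulʳ f g ord i i<t = trans (mul-comm f g i) (Ord≥-mulˡ g f ord i i<t)

  Ord≥-shiftS : ∀ e f → Ord≥ e (shiftS e f)
  Ord≥-shiftS e f i i<e = shiftS-≰ e f (ℕP.<⇒≱ i<e)

  Ord≥-shiftS-+ : ∀ {t} e f → Ord≥ t f → Ord≥ (e ℕ.+ t) (shiftS e f)
  Ord≥-shiftS-+ {t} e f ord i i<e+t with e ≤? i
  ... | yes e≤i = trans (shiftS-≤ e f e≤i) (ord (i ∸ e) (subst (i ∸ e <_) (ℕP.m+n∸m≡n e t) (ℕP.∸-monoˡ-< i<e+t e≤i)))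
  ... | no e≰i  = shiftS-≰ e f e≰i

  Ord≥-scaleS : ∀ {t} c f → Ord≥ t f → Ord≥ t (scaleS c f)
  Ord≥-scaleS c f ord i i<t = trans (cong (c *_) (ord i i<t)) (ℤP.*-zeroʳ c)

  Ord≥-subS : ∀ {t} f g → Ord≥ t f → Ord≥ t g → Ord≥ t (subS f g)
  Ord≥-subS f g ordf ordg i i<t = cong₂ _-_ (ordf i i<t) (ordg i i<t)

  Summable : (ℕ → Series) → Set
  Summable F = ∀ n → Ord≥ n (F n)

  -- Meaningful for Summable families only: coefficient N then needs just the terms n ≤ N.
  sum∞ : (ℕ → Series) → Series
  sum∞ F N = sumTo (suc N) (λ n → F n N)

  sumS : ℕ → (ℕ → Series) → Series
  sumS A F i = sumTo A (λ n → F n i)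

  sum∞-cong : ∀ {F G} → (∀ n → F n ≗ G n) → sum∞ F ≗ sum∞ G
  sum∞-cong e N = sumTo-cong (suc N) (λ n → e n N)

  sum∞-truncate : ∀ F → Summable F → ∀ {N} L → N < L → sum∞ F N ≡ sumTo L (λ n → F n N)
  sum∞-truncate F summable {N} L N<L = sym (sumTo-vanishing (suc N) L _ (λ n N<n → summable n N N<n) N<L)

  sum∞-≗[]-sumS : ∀ F → Summable F → ∀ {N} A → N < A → sum∞ F ≗[ N ] sumS A F
  sum∞-≗[]-sumS F summable A N<A i i≤N = sum∞-truncate F summable A (ℕP.≤-<-trans i≤N N<A)

  sum∞-subS : ∀ F G → sum∞ (λ n → subS (F n) (G n)) ≗ subS (sum∞ F) (sum∞ G)
  sum∞-subS F G N = sumTo-- (suc N) _ _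

  sum∞-scaleS : ∀ c F → sum∞ (λ n → scaleS c (F n)) ≗ scaleS c (sum∞ F)
  sum∞-scaleS c F N = sym (sumTo-*ˡ (suc N) c _)

  sum∞-uncons : ∀ F → Summable F → sum∞ F ≗ addS (F 0) (sum∞ (λ n → F (suc n)))
  sum∞-uncons F summable N = trans (sumTo-first N _) (cong (λ x → F 0 N + x)
    (sym (trans (cong (λ x → sumTo N (λ n → F (suc n) N) + x) (summable (suc N) N ℕP.≤-refl)) (ℤP.+-identityʳ _))))

  Summable-mul : ∀ g F → Summable F → Summable (λ n → mul g (F n))
  Summable-mul g F summable n = Ord≥-mulʳ g (F n) (summable n)

  mul-sum∞ : ∀ g F → Summable F → mul g (sum∞ F) ≗ sum∞ (λ n → mul g (F n))
  mul-sum∞ g F summable N = begin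
    sumTo (suc N) (λ i → g i * sum∞ F (N ∸ i))
      ≡⟨ sumTo-cong< (suc N) (λ i i≤N → cong (g i *_) (sum∞-truncate F summable (suc N) (s≤s (ℕP.m∸n≤m N i)))) ⟩
    sumTo (suc N) (λ i → g i * sumTo (suc N) (λ n → F n (N ∸ i)))
      ≡⟨ sumTo-cong (suc N) (λ i → sumTo-*ˡ (suc N) (g i) (λ n → F n (N ∸ i))) ⟩
    sumTo (suc N) (λ i → sumTo (suc N) (λ n → g i * F n (N ∸ i)))
      ≡⟨ sumTo-swap (suc N) (suc N) (λ i n → g i * F n (N ∸ i)) ⟩
    sum∞ (λ n → mul g (F n)) N
      ∎
    where open ≡-Reasoning

  shiftS-sum∞ : ∀ e F → Summable F → shiftS e (sum∞ F) ≗ sum∞ (λ n → shiftS e (F n))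
  shiftS-sum∞ e F summable = begin
    shiftS e (sum∞ F)                    ≈⟨ mul-monoSˡ e (sum∞ F) ⟨
    mul (monoS e) (sum∞ F)               ≈⟨ mul-sum∞ (monoS e) F summable ⟩
    sum∞ (λ n → mul (monoS e) (F n))     ≈⟨ sum∞-cong (λ n → mul-monoSˡ e (F n)) ⟩
    sum∞ (λ n → shiftS e (F n))          ∎
    where open ≗-Reasoning

  mul-sum∞-sum∞ : ∀ F G → Summable F → Summable G → ∀ {N} A → N < A →
    mul (sum∞ F) (sum∞ G) N ≡ sumTo A (λ m → sumTo A (λ n → mul (F m) (G n) N))
  mul-sum∞-sum∞ F G summableF summableG {N} A N<A = begin
    mul (sum∞ F) (sum∞ G) N
      ≡⟨ mul-sum∞ (sum∞ F) G summableG N ⟩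
    sum∞ (λ n → mul (sum∞ F) (G n)) N
      ≡⟨ sum∞-truncate _ (Summable-mul (sum∞ F) G summableG) A N<A ⟩
    sumTo A (λ n → mul (sum∞ F) (G n) N)
      ≡⟨ sumTo-cong A column ⟩
    sumTo A (λ n → sumTo A (λ m → mul (F m) (G n) N))
      ≡⟨ sumTo-swap A A (λ n m → mul (F m) (G n) N) ⟩
    sumTo A (λ m → sumTo A (λ n → mul (F m) (G n) N))
      ∎
    where
    open ≡-Reasoning
    column : ∀ n → mul (sum∞ F) (G n) N ≡ sumTo A (λ m → mul (F m) (G n) N)
    column n = begin
      mul (sum∞ F) (G n) N                 ≡⟨ mul-comm (sum∞ F) (G n) N ⟩
      mul (G n) (sum∞ F) N                 ≡⟨ mul-sum∞ (G n) F summableF N ⟩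
      sum∞ (λ m → mul (G n) (F m)) N       ≡⟨ sum∞-truncate _ (Summable-mul (G n) F summableF) A N<A ⟩
      sumTo A (λ m → mul (G n) (F m) N)    ≡⟨ sumTo-cong A (λ m → mul-comm (G n) (F m) N) ⟩
      sumTo A (λ m → mul (F m) (G n) N)    ∎

  sumS-cong : ∀ A {F G} → (∀ n → F n ≗ G n) → sumS A F ≗ sumS A G
  sumS-cong A e i = sumTo-cong A (λ n → e n i)

  mul-sumSˡ : ∀ A F g → mul (sumS A F) g ≗ sumS A (λ n → mul (F n) g)
  mul-sumSˡ A F g N = trans (sumTo-cong (suc N) (λ i → sumTo-*ʳ A (g (N ∸ i)) (λ n → F n i)))
    (sumTo-swap (suc N) A (λ i n → F n i * g (N ∸ i)))

  shiftS-sumS : ∀ e A F → shiftS e (sumS A F) ≗ sumS A (λ n → shiftS e (F n))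
  shiftS-sumS e A F N with e ≤? N
  ... | yes e≤N = trans (shiftS-≤ e (sumS A F) e≤N) (sumTo-cong A (λ n → sym (shiftS-≤ e (F n) e≤N)))
  ... | no e≰N  = trans (shiftS-≰ e (sumS A F) e≰N) (sym (sumTo-zero A (λ n _ → shiftS-≰ e (F n) e≰N)))

  scaleS-sumS : ∀ c A F → scaleS c (sumS A F) ≗ sumS A (λ n → scaleS c (F n))
  scaleS-sumS c A F N = sumTo-*ˡ A c (λ n → F n N)

  finProd-cong : ∀ n {F G} → (∀ i → F i ≗ G i) → finProd n F ≗ finProd n G
  finProd-cong zero    e = λ _ → refl
  finProd-cong (suc n) e = mul-cong (finProd-cong n e) (e n)

  finProd-stable : ∀ {N} L n F → (∀ i → L ≤ i → F i ≗[ N ] oneS) → L ≤ n → finProd n F ≗[ N ] finProd L F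
  finProd-stable {N} L n F trivial L≤n = subst (λ x → finProd x F ≗[ N ] finProd L F) (ℕP.m+[n∸m]≡n L≤n) (extend (n ∸ L))
    where
    extend : ∀ d → finProd (L ℕ.+ d) F ≗[ N ] finProd L F
    extend zero    rewrite ℕP.+-identityʳ L = λ _ _ → refl
    extend (suc d) rewrite ℕP.+-suc L d =
      ≗[]-trans (mul-cong[] (extend d) (trivial (L ℕ.+ d) (ℕP.m≤m+n L d))) (≗⇒≗[] N (mul-identityʳ (finProd L F)))

  finProd-mul : ∀ n F G → mul (finProd n F) (finProd n G) ≗ finProd n (λ i → mul (F i) (G i))
  finProd-mul zero    F G = mul-identityˡ oneS
  finProd-mul (suc n) F G i =
    trans (mul-interchange (finProd n F) (F n) (finProd n G) (G n) i) (mul-congʳ (mul (F n) (G n)) (finProd-mul n F G) i)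

  finProd-oneS : ∀ n F → (∀ i → F i ≗ oneS) → finProd n F ≗ oneS
  finProd-oneS zero    F e = λ _ → refl
  finProd-oneS (suc n) F e i = trans (mul-cong (finProd-oneS n F e) (e n) i) (mul-identityˡ oneS i)

module Exponents where

  open import Data.Nat using (_+_; _*_)
  open ≡-Reasoning

  choose2 : ℕ → ℕ
  choose2 zero    = 0
  choose2 (suc n) = choose2 n + n

  eulerExp : ℕ → ℕ → ℕ → ℕ
  eulerExp k b n = k * choose2 n + b * n

  choose2-+ : ∀ m n → choose2 (m + n) ≡ choose2 m + choose2 n + m * n
  choose2-+ m zero    rewrite ℕP.+-identityʳ m | ℕP.*-zeroʳ m | ℕP.+-identityʳ (choose2 m) = sym (ℕP.+-identityʳ _)
  choose2-+ m (suc n) rewrite ℕP.+-suc m n | choose2-+ m n = ring (choose2 m) (choose2 n) m n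
    where
    ring : ∀ a b m n → a + b + m * n + (m + n) ≡ a + (b + n) + m * suc n
    ring = ℕ-Ring.solve-∀

  choose2-double : ∀ n → choose2 n + choose2 n + n ≡ n * n
  choose2-double zero    = refl
  choose2-double (suc n) = begin
    (c + n) + (c + n) + suc n  ≡⟨ ring₁ c n ⟩
    (c + c + n) + n + suc n    ≡⟨ cong (λ x → x + n + suc n) (choose2-double n) ⟩
    n * n + n + suc n          ≡⟨ ring₂ n ⟩
    suc n * suc n              ∎
    where
    c = choose2 n
    ring₁ : ∀ c n → (c + n) + (c + n) + suc n ≡ (c + c + n) + n + suc n
    ring₁ = ℕ-Ring.solve-∀
    ring₂ : ∀ n → n * n + n + suc n ≡ suc n * suc n
    ring₂ = ℕ-Ring.solve-∀

  eulerExp-pair : ∀ {k} b c → b + c ≡ k → ∀ n p →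
    eulerExp k c (n + p) + eulerExp k b n ≡ eulerExp k c p + k * (n * (n + p))
  eulerExp-pair b c refl n p = begin
    (b + c) * choose2 (n + p) + c * (n + p) + ((b + c) * choose2 n + b * n)
      ≡⟨ cong (λ x → (b + c) * x + c * (n + p) + ((b + c) * choose2 n + b * n)) (choose2-+ n p) ⟩
    (b + c) * (choose2 n + choose2 p + n * p) + c * (n + p) + ((b + c) * choose2 n + b * n)
      ≡⟨ ring b c n p (choose2 n) (choose2 p) ⟩
    (b + c) * choose2 p + c * p + (b + c) * ((choose2 n + choose2 n + n) + n * p)
      ≡⟨ cong (λ x → (b + c) * choose2 p + c * p + (b + c) * (x + n * p)) (choose2-double n) ⟩
    (b + c) * choose2 p + c * p + (b + c) * (n * n + n * p)
      ≡⟨ cong (λ x → (b + c) * choose2 p + c * p + (b + c) * x) (ℕP.*-distribˡ-+ n n p) ⟨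
    (b + c) * choose2 p + c * p + (b + c) * (n * (n + p))
      ∎
    where
    ring : ∀ b c n p x y →
      (b + c) * (x + y + n * p) + c * (n + p) + ((b + c) * x + b * n)
        ≡ (b + c) * y + c * p + (b + c) * ((x + x + n) + n * p)
    ring = ℕ-Ring.solve-∀

module EulerDurfee where

  open import Data.Integer using (_+_; _*_; -_; _-_)
  open FiniteSums
  open PowerSeries
  open Exponents

  sign : ℕ → ℤ
  sign n = -[1+ 0 ] ℤ.^ n

  sign-+ : ∀ m n → sign (m ℕ.+ n) ≡ sign m * sign n
  sign-+ = ℤP.^-distribˡ-+-* -[1+ 0 ]

  sign-square : ∀ n → sign n * sign n ≡ + 1
  sign-square zero    = refl
  sign-square (suc n) = trans (square-neg (sign n)) (sign-square n)
    where
    square-neg : ∀ x → (-[1+ 0 ] * x) * (-[1+ 0 ] * x) ≡ x * x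
    square-neg = solve-∀

  sign-offset : ∀ n p → sign n * sign (n ℕ.+ p) ≡ sign p
  sign-offset n p = begin
    sign n * sign (n ℕ.+ p)         ≡⟨ cong (sign n *_) (sign-+ n p) ⟩
    sign n * (sign n * sign p)      ≡⟨ ℤP.*-assoc (sign n) (sign n) (sign p) ⟨
    sign n * sign n * sign p        ≡⟨ cong (_* sign p) (sign-square n) ⟩
    + 1 * sign p                    ≡⟨ ℤP.*-identityˡ (sign p) ⟩
    sign p                          ∎
    where open ≡-Reasoning

  module _ (k : ℕ) where

    invPochK : ℕ → Series
    invPochK n = finProd n (λ i → geom (k ℕ.* suc i))

    invPochK∞ : Series
    invPochK∞ N = invPochK (suc N) N

    eulerTerm : ℕ → ℕ → Series
    eulerTerm b n = scaleS (sign n) (shiftS (eulerExp k b n) (invPochK n))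

    eulerSum : ℕ → Series
    eulerSum b = sum∞ (eulerTerm b)

    durfeeTerm : ℕ → ℕ → Series
    durfeeTerm r n = shiftS (k ℕ.* (n ℕ.* (n ℕ.+ r))) (mul (invPochK n) (invPochK (n ℕ.+ r)))

    durfeeSum : ℕ → Series
    durfeeSum r = sum∞ (durfeeTerm r)

    durfeeTerm⁺ : ℕ → ℕ → Series
    durfeeTerm⁺ r n = shiftS (k ℕ.* (n ℕ.* (n ℕ.+ r))) (mul (invPochK n) (invPochK (suc (n ℕ.+ r))))

    durfeeGap : ℕ → Series
    durfeeGap r = subS (durfeeSum r) (durfeeSum (suc r))

    module _ (1≤k : 1 ≤ k) where

      m≤k*m : ∀ m → m ≤ k ℕ.* m
      m≤k*m m = ℕP.m≤n*m m k {{ℕ.>-nonZero 1≤k}}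

      m<k*[1+m] : ∀ m → m < k ℕ.* suc m
      m<k*[1+m] m = m≤k*m (suc m)

      geom-oneMinus-k : ∀ m → mul (geom (k ℕ.* suc m)) (oneMinus (k ℕ.* suc m)) ≗ oneS
      geom-oneMinus-k m = geom-oneMinus (k ℕ.* suc m) (ℕP.≤-trans (s≤s z≤n) (m<k*[1+m] m))

      invPochK-suc : ∀ m → mul (invPochK (suc m)) (oneMinus (k ℕ.* suc m)) ≗ invPochK m
      invPochK-suc m = begin
        mul (mul (invPochK m) (geom e)) (oneMinus e)   ≈⟨ mul-assoc (invPochK m) (geom e) (oneMinus e) ⟩
        mul (invPochK m) (mul (geom e) (oneMinus e))   ≈⟨ mul-congˡ (invPochK m) (geom-oneMinus-k m) ⟩
        mul (invPochK m) oneS                          ≈⟨ mul-identityʳ (invPochK m) ⟩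
        invPochK m                                     ∎
        where
        open ≗-Reasoning
        e = k ℕ.* suc m

      invPochK-stable : ∀ n {i} → i < n → invPochK n i ≡ invPochK∞ i
      invPochK-stable n {i} i<n = finProd-stable (suc i) n _
        (λ m i<m → geom-≗[]-oneS (k ℕ.* suc m) (ℕP.<-trans i<m (m<k*[1+m] m))) i<n i ℕP.≤-refl

      pochInf-k-stable : ∀ n {i} → i < n → finProd n (λ m → oneMinus (k ℕ.* suc m)) i ≡ pochInf k k i
      pochInf-k-stable n {i} i<n = trans
        (finProd-stable (suc i) n _
          (λ m i<m → oneMinus-≗[]-oneS (k ℕ.* suc m) (ℕP.<-trans i<m (m<k*[1+m] m))) i<n i ℕP.≤-refl)
        (finProd-cong (suc i) (λ m N → cong (λ e → oneMinus e N) (k*[1+m]≡k+m*k m)) i)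
        where
        k*[1+m]≡k+m*k : ∀ m → k ℕ.* suc m ≡ k ℕ.+ m ℕ.* k
        k*[1+m]≡k+m*k m = trans (ℕP.*-suc k m) (cong (k ℕ.+_) (ℕP.*-comm k m))

      invPochK∞-pochInf : mul invPochK∞ (pochInf k k) ≗ oneS
      invPochK∞-pochInf N = begin
        mul invPochK∞ (pochInf k k) N
          ≡⟨ mul-cong[] (λ i i≤N → sym (invPochK-stable (suc N) (s≤s i≤N)))
                        (λ i i≤N → sym (pochInf-k-stable (suc N) (s≤s i≤N))) N ℕP.≤-refl ⟩
        mul (invPochK (suc N)) (finProd (suc N) (λ m → oneMinus (k ℕ.* suc m))) N
          ≡⟨ finProd-mul (suc N) _ _ N ⟩
        finProd (suc N) (λ m → mul (geom (k ℕ.* suc m)) (oneMinus (k ℕ.* suc m))) N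
          ≡⟨ finProd-oneS (suc N) _ geom-oneMinus-k N ⟩
        oneS N
          ∎
        where open ≡-Reasoning

      eulerTerm-summable : ∀ b → 1 ≤ b → Summable (eulerTerm b)
      eulerTerm-summable b 1≤b n = Ord≥-scaleS (sign n) _
        (Ord≥-weaken (ℕP.≤-trans (ℕP.m≤n*m n b {{ℕ.>-nonZero 1≤b}}) (ℕP.m≤n+m (b ℕ.* n) _))
                     (Ord≥-shiftS (eulerExp k b n) (invPochK n)))

      eulerTerm-zero : ∀ b → eulerTerm b 0 ≗ oneS
      eulerTerm-zero b N = trans (ℤP.*-identityˡ _)
        (trans (shiftS-≡ oneS (cong₂ ℕ._+_ (ℕP.*-zeroʳ k) (ℕP.*-zeroʳ b)) N) (shiftS-zero oneS N))

      eulerTerm-difference : ∀ b m →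
        subS (eulerTerm b (suc m)) (eulerTerm (b ℕ.+ k) (suc m)) ≗ scaleS -[1+ 0 ] (shiftS b (eulerTerm (b ℕ.+ k) m))
      eulerTerm-difference b m = begin
        subS (scaleS σ (shiftS X I)) (scaleS σ (shiftS (eulerExp k (b ℕ.+ k) (suc m)) I))
          ≈⟨ subS-cong {scaleS σ (shiftS X I)} (λ _ → refl)
               (scaleS-cong σ (λ N → trans (shiftS-≡ I exp-+k N) (sym (shiftS-shiftS X e I N)))) ⟩
        subS (scaleS σ (shiftS X I)) (scaleS σ (shiftS X (shiftS e I)))
          ≈⟨ scaleS-subS σ _ _ ⟨
        scaleS σ (subS (shiftS X I) (shiftS X (shiftS e I)))
          ≈⟨ scaleS-cong σ (shiftS-subS X I (shiftS e I)) ⟨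
        scaleS σ (shiftS X (subS I (shiftS e I)))
          ≈⟨ scaleS-cong σ (shiftS-cong X (λ N → trans (sym (mul-oneMinusʳ e I N)) (invPochK-suc m N))) ⟩
        scaleS σ (shiftS X (invPochK m))
          ≈⟨ scaleS-cong σ (λ N → trans (shiftS-≡ (invPochK m) exp-shift N)
                                        (sym (shiftS-shiftS b (eulerExp k (b ℕ.+ k) m) (invPochK m) N))) ⟩
        scaleS σ (shiftS b (shiftS (eulerExp k (b ℕ.+ k) m) (invPochK m)))
          ≈⟨ scaleS-scaleS -[1+ 0 ] (sign m) (shiftS b (shiftS (eulerExp k (b ℕ.+ k) m) (invPochK m))) ⟨
        scaleS -[1+ 0 ] (scaleS (sign m) (shiftS b (shiftS (eulerExp k (b ℕ.+ k) m) (invPochK m))))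
          ≈⟨ scaleS-cong -[1+ 0 ] (shiftS-scaleS b (sign m) (shiftS (eulerExp k (b ℕ.+ k) m) (invPochK m))) ⟨
        scaleS -[1+ 0 ] (shiftS b (eulerTerm (b ℕ.+ k) m))
          ∎
        where
        open ≗-Reasoning
        σ = sign (suc m)
        X = eulerExp k b (suc m)
        e = k ℕ.* suc m
        I = invPochK (suc m)
        exp-+k : eulerExp k (b ℕ.+ k) (suc m) ≡ X ℕ.+ e
        exp-+k = ring k b (choose2 (suc m)) m
          where
          ring : ∀ k b c m → k ℕ.* c ℕ.+ (b ℕ.+ k) ℕ.* suc m ≡ (k ℕ.* c ℕ.+ b ℕ.* suc m) ℕ.+ k ℕ.* suc m
          ring = ℕ-Ring.solve-∀
        exp-shift : X ≡ b ℕ.+ eulerExp k (b ℕ.+ k) m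
        exp-shift = ring k b (choose2 m) m
          where
          ring : ∀ k b c m → k ℕ.* (c ℕ.+ m) ℕ.+ b ℕ.* suc m ≡ b ℕ.+ (k ℕ.* c ℕ.+ (b ℕ.+ k) ℕ.* m)
          ring = ℕ-Ring.solve-∀

      eulerSum-difference : ∀ b → 1 ≤ b →
        subS (eulerSum b) (eulerSum (b ℕ.+ k)) ≗ scaleS -[1+ 0 ] (shiftS b (eulerSum (b ℕ.+ k)))
      eulerSum-difference b 1≤b = begin
        subS (eulerSum b) (eulerSum (b ℕ.+ k))
          ≈⟨ sum∞-subS (eulerTerm b) (eulerTerm (b ℕ.+ k)) ⟨
        sum∞ D
          ≈⟨ sum∞-uncons D summableD ⟩
        addS (D 0) (sum∞ (λ m → D (suc m)))
          ≈⟨ (λ N → trans (cong₂ _+_ (D₀≡0 N) (sum∞-cong (eulerTerm-difference b) N)) (ℤP.+-identityˡ _)) ⟩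
        sum∞ (λ m → scaleS -[1+ 0 ] (shiftS b (eulerTerm (b ℕ.+ k) m)))
          ≈⟨ sum∞-scaleS -[1+ 0 ] _ ⟩
        scaleS -[1+ 0 ] (sum∞ (λ m → shiftS b (eulerTerm (b ℕ.+ k) m)))
          ≈⟨ scaleS-cong -[1+ 0 ] (shiftS-sum∞ b (eulerTerm (b ℕ.+ k)) (eulerTerm-summable (b ℕ.+ k) 1≤b+k)) ⟨
        scaleS -[1+ 0 ] (shiftS b (eulerSum (b ℕ.+ k)))
          ∎
        where
        open ≗-Reasoning
        1≤b+k = ℕP.≤-trans 1≤b (ℕP.m≤m+n b k)
        D = λ n → subS (eulerTerm b n) (eulerTerm (b ℕ.+ k) n)
        summableD : Summable D
        summableD n = Ord≥-subS _ _ (eulerTerm-summable b 1≤b n) (eulerTerm-summable (b ℕ.+ k) 1≤b+k n)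
        D₀≡0 : ∀ N → D 0 N ≡ + 0
        D₀≡0 N = trans (cong₂ _-_ (eulerTerm-zero b N) (eulerTerm-zero (b ℕ.+ k) N)) (ℤP.+-inverseʳ (oneS N))

      eulerSum-rec : ∀ b → 1 ≤ b → eulerSum b ≗ mul (eulerSum (b ℕ.+ k)) (oneMinus b)
      eulerSum-rec b 1≤b N = begin
        S N                                   ≡⟨ a≡c+[a-c] (S N) (S′ N) ⟩
        S′ N + (S N - S′ N)                   ≡⟨ cong (λ x → S′ N + x) (trans (eulerSum-difference b 1≤b N) (ℤP.-1*i≡-i _)) ⟩
        S′ N - shiftS b S′ N                  ≡⟨ mul-oneMinusʳ b S′ N ⟨
        mul S′ (oneMinus b) N                 ∎
        where
        open ≡-Reasoning
        S = eulerSum b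
        S′ = eulerSum (b ℕ.+ k)
        a≡c+[a-c] : ∀ a c → a ≡ c + (a - c)
        a≡c+[a-c] = solve-∀

      eulerSum-product : ∀ b → 1 ≤ b → ∀ L →
        eulerSum b ≗ mul (eulerSum (b ℕ.+ L ℕ.* k)) (finProd L (λ i → oneMinus (b ℕ.+ i ℕ.* k)))
      eulerSum-product b 1≤b zero N =
        trans (cong (λ c → eulerSum c N) (sym (ℕP.+-identityʳ b))) (sym (mul-identityʳ (eulerSum (b ℕ.+ 0)) N))
      eulerSum-product b 1≤b (suc L) = begin
        eulerSum b
          ≈⟨ eulerSum-product b 1≤b L ⟩
        mul (eulerSum c) P
          ≈⟨ mul-congʳ P (eulerSum-rec c (ℕP.≤-trans 1≤b (ℕP.m≤m+n b _))) ⟩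
        mul (mul (eulerSum (c ℕ.+ k)) (oneMinus c)) P
          ≈⟨ mul-assoc (eulerSum (c ℕ.+ k)) (oneMinus c) P ⟩
        mul (eulerSum (c ℕ.+ k)) (mul (oneMinus c) P)
          ≈⟨ mul-cong (λ N → cong (λ x → eulerSum x N) c+k≡) (mul-comm (oneMinus c) P) ⟩
        mul (eulerSum (b ℕ.+ suc L ℕ.* k)) (mul P (oneMinus c))
          ∎
        where
        open ≗-Reasoning
        c = b ℕ.+ L ℕ.* k
        P = finProd L (λ i → oneMinus (b ℕ.+ i ℕ.* k))
        c+k≡ : c ℕ.+ k ≡ b ℕ.+ suc L ℕ.* k
        c+k≡ = trans (ℕP.+-assoc b _ k) (cong (b ℕ.+_) (ℕP.+-comm (L ℕ.* k) k))

      eulerSum-≗[]-oneS : ∀ b → 1 ≤ b → ∀ {N} → N < b → eulerSum b ≗[ N ] oneS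
      eulerSum-≗[]-oneS b 1≤b N<b i i≤N =
        trans (sum∞-uncons (eulerTerm b) (eulerTerm-summable b 1≤b) i)
              (trans (cong₂ _+_ (eulerTerm-zero b i) (sumTo-zero (suc i) (λ n _ → higher n i i<b))) (ℤP.+-identityʳ _))
        where
        i<b = ℕP.≤-<-trans i≤N N<b
        higher : ∀ n → Ord≥ b (eulerTerm b (suc n))
        higher n = Ord≥-scaleS (sign (suc n)) _ (Ord≥-weaken b≤exp (Ord≥-shiftS (eulerExp k b (suc n)) (invPochK (suc n))))
          where
          b≤exp : b ≤ eulerExp k b (suc n)
          b≤exp = ℕP.≤-trans (ℕP.m≤m*n b (suc n)) (ℕP.m≤n+m (b ℕ.* suc n) _)

      euler : ∀ b → 1 ≤ b → pochInf b k ≗ eulerSum b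
      euler b 1≤b N = sym (begin
        eulerSum b N
          ≡⟨ eulerSum-product b 1≤b (suc N) N ⟩
        mul (eulerSum (b ℕ.+ suc N ℕ.* k)) P N
          ≡⟨ mul-cong[] {g = P} (eulerSum-≗[]-oneS _ (ℕP.≤-trans 1≤b (ℕP.m≤m+n b _)) N<) (λ _ _ → refl) N ℕP.≤-refl ⟩
        mul oneS P N
          ≡⟨ mul-identityˡ P N ⟩
        pochInf b k N
          ∎)
        where
        open ≡-Reasoning
        P = finProd (suc N) (λ i → oneMinus (b ℕ.+ i ℕ.* k))
        N< : N < b ℕ.+ suc N ℕ.* k
        N< = ℕP.<-≤-trans (ℕP.≤-trans (m≤k*m (suc N)) (ℕP.≤-reflexive (ℕP.*-comm k (suc N)))) (ℕP.m≤n+m _ b)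

      n≤durfeeExp : ∀ r n → n ≤ k ℕ.* (n ℕ.* (n ℕ.+ r))
      n≤durfeeExp r zero    = z≤n
      n≤durfeeExp r (suc n) = ℕP.≤-trans (ℕP.m≤m*n (suc n) (suc n ℕ.+ r)) (m≤k*m _)

      durfeeTerm-summable : ∀ r → Summable (durfeeTerm r)
      durfeeTerm-summable r n =
        Ord≥-weaken (n≤durfeeExp r n) (Ord≥-shiftS (k ℕ.* (n ℕ.* (n ℕ.+ r))) (mul (invPochK n) (invPochK (n ℕ.+ r))))

      durfeeTerm⁺-summable : ∀ r → Summable (durfeeTerm⁺ r)
      durfeeTerm⁺-summable r n =
        Ord≥-weaken (n≤durfeeExp r n) (Ord≥-shiftS (k ℕ.* (n ℕ.* (n ℕ.+ r))) (mul (invPochK n) (invPochK (suc (n ℕ.+ r)))))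

      durfeeTerm-peel : ∀ r n → durfeeTerm r n ≗ subS (durfeeTerm⁺ r n) (shiftS (k ℕ.* suc r) (durfeeTerm (suc r) n))
      durfeeTerm-peel r n = begin
        shiftS x (mul (invPochK n) (invPochK (n ℕ.+ r)))
          ≈⟨ shiftS-cong x (mul-congˡ (invPochK n) (λ N → trans (sym (invPochK-suc (n ℕ.+ r) N)) (mul-oneMinusʳ e P N))) ⟩
        shiftS x (mul (invPochK n) (subS P (shiftS e P)))
          ≈⟨ shiftS-cong x (λ N → trans (mul-subS (invPochK n) P (shiftS e P) N)
                                        (cong (λ y → Q N - y) (mul-shiftSʳ e (invPochK n) P N))) ⟩
        shiftS x (subS Q (shiftS e Q))
          ≈⟨ shiftS-subS x Q (shiftS e Q) ⟩
        subS (shiftS x Q) (shiftS x (shiftS e Q))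
          ≈⟨ subS-cong {shiftS x Q} (λ _ → refl) lower ⟩
        subS (durfeeTerm⁺ r n) (shiftS (k ℕ.* suc r) (durfeeTerm (suc r) n))
          ∎
        where
        open ≗-Reasoning
        x = k ℕ.* (n ℕ.* (n ℕ.+ r))
        e = k ℕ.* suc (n ℕ.+ r)
        P = invPochK (suc (n ℕ.+ r))
        Q = mul (invPochK n) P
        exps : x ℕ.+ e ≡ k ℕ.* suc r ℕ.+ k ℕ.* (n ℕ.* (n ℕ.+ suc r))
        exps = ring k n r
          where
          ring : ∀ k n r → k ℕ.* (n ℕ.* (n ℕ.+ r)) ℕ.+ k ℕ.* suc (n ℕ.+ r) ≡ k ℕ.* suc r ℕ.+ k ℕ.* (n ℕ.* (n ℕ.+ suc r))
          ring = ℕ-Ring.solve-∀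
        lower : shiftS x (shiftS e Q) ≗ shiftS (k ℕ.* suc r) (durfeeTerm (suc r) n)
        lower = begin
          shiftS x (shiftS e Q)                                         ≈⟨ shiftS-shiftS x e Q ⟩
          shiftS (x ℕ.+ e) Q                                            ≈⟨ shiftS-≡ Q exps ⟩
          shiftS (k ℕ.* suc r ℕ.+ k ℕ.* (n ℕ.* (n ℕ.+ suc r))) Q        ≈⟨ shiftS-shiftS (k ℕ.* suc r) _ Q ⟨
          shiftS (k ℕ.* suc r) (shiftS (k ℕ.* (n ℕ.* (n ℕ.+ suc r))) Q)
            ≈⟨ shiftS-cong (k ℕ.* suc r) (shiftS-cong (k ℕ.* (n ℕ.* (n ℕ.+ suc r)))
                 (mul-congˡ (invPochK n) (λ i → cong (λ m → invPochK m i) (sym (ℕP.+-suc n r))))) ⟩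
          shiftS (k ℕ.* suc r) (durfeeTerm (suc r) n)                  ∎

      durfeeTerm⁺-sub : ∀ r m →
        subS (durfeeTerm⁺ r (suc m)) (durfeeTerm (suc r) (suc m)) ≗ shiftS (k ℕ.* suc r) (durfeeTerm (suc (suc r)) m)
      durfeeTerm⁺-sub r m = begin
        subS (shiftS x R) (durfeeTerm (suc r) (suc m))
          ≈⟨ subS-cong {shiftS x R} (λ _ → refl) upper ⟩
        subS (shiftS x R) (shiftS x (shiftS e R))
          ≈⟨ shiftS-subS x R (shiftS e R) ⟨
        shiftS x (subS R (shiftS e R))
          ≈⟨ shiftS-cong x (mul-oneMinusʳ e R) ⟨
        shiftS x (mul (mul (invPochK (suc m)) T) (oneMinus e))
          ≈⟨ shiftS-cong x (mul-swapʳ (invPochK (suc m)) T (oneMinus e)) ⟩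
        shiftS x (mul (mul (invPochK (suc m)) (oneMinus e)) T)
          ≈⟨ shiftS-cong x (mul-cong (invPochK-suc m) (λ i → cong (λ l → invPochK l i) index)) ⟩
        shiftS x (mul (invPochK m) (invPochK (m ℕ.+ suc (suc r))))
          ≈⟨ shiftS-≡ (mul (invPochK m) (invPochK (m ℕ.+ suc (suc r)))) exps ⟩
        shiftS (k ℕ.* suc r ℕ.+ y) (mul (invPochK m) (invPochK (m ℕ.+ suc (suc r))))
          ≈⟨ shiftS-shiftS (k ℕ.* suc r) y (mul (invPochK m) (invPochK (m ℕ.+ suc (suc r)))) ⟨
        shiftS (k ℕ.* suc r) (durfeeTerm (suc (suc r)) m)
          ∎
        where
        open ≗-Reasoning
        x = k ℕ.* (suc m ℕ.* (suc m ℕ.+ r))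
        y = k ℕ.* (m ℕ.* (m ℕ.+ suc (suc r)))
        e = k ℕ.* suc m
        T = invPochK (suc (suc m ℕ.+ r))
        R = mul (invPochK (suc m)) T
        index : suc (suc m ℕ.+ r) ≡ m ℕ.+ suc (suc r)
        index = sym (trans (ℕP.+-suc m (suc r)) (cong suc (ℕP.+-suc m r)))
        exps : x ≡ k ℕ.* suc r ℕ.+ y
        exps = ring k m r
          where
          ring : ∀ k m r → k ℕ.* (suc m ℕ.* (suc m ℕ.+ r)) ≡ k ℕ.* suc r ℕ.+ k ℕ.* (m ℕ.* (m ℕ.+ suc (suc r)))
          ring = ℕ-Ring.solve-∀
        upper : durfeeTerm (suc r) (suc m) ≗ shiftS x (shiftS e R)
        upper = begin
          shiftS (k ℕ.* (suc m ℕ.* (suc m ℕ.+ suc r))) (mul (invPochK (suc m)) (invPochK (suc m ℕ.+ suc r)))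
            ≈⟨ shiftS-cong (k ℕ.* (suc m ℕ.* (suc m ℕ.+ suc r)))
                 (mul-congˡ (invPochK (suc m)) (λ i → cong (λ l → invPochK l i) (ℕP.+-suc (suc m) r))) ⟩
          shiftS (k ℕ.* (suc m ℕ.* (suc m ℕ.+ suc r))) R
            ≈⟨ shiftS-≡ R (ring k m r) ⟩
          shiftS (x ℕ.+ e) R
            ≈⟨ shiftS-shiftS x e R ⟨
          shiftS x (shiftS e R)
            ∎
          where
          ring : ∀ k m r → k ℕ.* (suc m ℕ.* (suc m ℕ.+ suc r)) ≡ k ℕ.* (suc m ℕ.* (suc m ℕ.+ r)) ℕ.+ k ℕ.* suc m
          ring = ℕ-Ring.solve-∀

      sum∞-durfeeTerm⁺-sub : ∀ r →
        subS (sum∞ (durfeeTerm⁺ r)) (durfeeSum (suc r)) ≗ shiftS (k ℕ.* suc r) (durfeeSum (suc (suc r)))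
      sum∞-durfeeTerm⁺-sub r = begin
        subS (sum∞ (durfeeTerm⁺ r)) (durfeeSum (suc r))
          ≈⟨ sum∞-subS (durfeeTerm⁺ r) (durfeeTerm (suc r)) ⟨
        sum∞ D
          ≈⟨ sum∞-uncons D summableD ⟩
        addS (D 0) (sum∞ (λ m → D (suc m)))
          -- durfeeTerm⁺ r 0 and durfeeTerm (suc r) 0 coincide definitionally
          ≈⟨ (λ N → trans (cong₂ _+_ (ℤP.+-inverseʳ (durfeeTerm⁺ r 0 N)) (sum∞-cong (durfeeTerm⁺-sub r) N))
                          (ℤP.+-identityˡ _)) ⟩
        sum∞ (λ m → shiftS (k ℕ.* suc r) (durfeeTerm (suc (suc r)) m))
          ≈⟨ shiftS-sum∞ (k ℕ.* suc r) (durfeeTerm (suc (suc r))) (durfeeTerm-summable (suc (suc r))) ⟨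
        shiftS (k ℕ.* suc r) (durfeeSum (suc (suc r)))
          ∎
        where
        open ≗-Reasoning
        D = λ n → subS (durfeeTerm⁺ r n) (durfeeTerm (suc r) n)
        summableD : Summable D
        summableD n = Ord≥-subS _ _ (durfeeTerm⁺-summable r n) (durfeeTerm-summable (suc r) n)

      durfeeSum-peel : ∀ r → durfeeSum r ≗ subS (sum∞ (durfeeTerm⁺ r)) (shiftS (k ℕ.* suc r) (durfeeSum (suc r)))
      durfeeSum-peel r = begin
        durfeeSum r
          ≈⟨ sum∞-cong (durfeeTerm-peel r) ⟩
        sum∞ (λ n → subS (durfeeTerm⁺ r n) (shiftS (k ℕ.* suc r) (durfeeTerm (suc r) n)))
          ≈⟨ sum∞-subS (durfeeTerm⁺ r) (λ n → shiftS (k ℕ.* suc r) (durfeeTerm (suc r) n)) ⟩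
        subS (sum∞ (durfeeTerm⁺ r)) (sum∞ (λ n → shiftS (k ℕ.* suc r) (durfeeTerm (suc r) n)))
          ≈⟨ subS-cong {sum∞ (durfeeTerm⁺ r)} (λ _ → refl)
               (shiftS-sum∞ (k ℕ.* suc r) (durfeeTerm (suc r)) (durfeeTerm-summable (suc r))) ⟨
        subS (sum∞ (durfeeTerm⁺ r)) (shiftS (k ℕ.* suc r) (durfeeSum (suc r)))
          ∎
        where open ≗-Reasoning

      durfeeGap-rec : ∀ r i → durfeeGap r i ≡ - shiftS (k ℕ.* suc r) (durfeeGap (suc r)) i
      durfeeGap-rec r i = begin
        D r i - D (suc r) i
          ≡⟨ cong (_- D (suc r) i) (durfeeSum-peel r i) ⟩
        (H i - shiftS e (D (suc r)) i) - D (suc r) i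
          ≡⟨ regroup (H i) (shiftS e (D (suc r)) i) (D (suc r) i) ⟩
        - (shiftS e (D (suc r)) i - (H i - D (suc r) i))
          ≡⟨ cong (λ y → - (shiftS e (D (suc r)) i - y)) (sum∞-durfeeTerm⁺-sub r i) ⟩
        - (shiftS e (D (suc r)) i - shiftS e (D (suc (suc r))) i)
          ≡⟨ cong -_ (shiftS-subS e (D (suc r)) (D (suc (suc r))) i) ⟨
        - shiftS e (durfeeGap (suc r)) i
          ∎
        where
        open ≡-Reasoning
        D = durfeeSum
        H = sum∞ (durfeeTerm⁺ r)
        e = k ℕ.* suc r
        regroup : ∀ a b c → (a - b) - c ≡ - (b - (a - c))
        regroup = solve-∀

      -- each step of the recurrence gains at least k(r+1) ≥ 1 powers of q
      durfeeGap-Ord≥ : ∀ t r → Ord≥ t (durfeeGap r)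
      durfeeGap-Ord≥ zero    r i ()
      durfeeGap-Ord≥ (suc t) r i i<1+t = trans (durfeeGap-rec r i)
        (cong -_ (Ord≥-shiftS-+ (k ℕ.* suc r) (durfeeGap (suc r)) (durfeeGap-Ord≥ t (suc r)) i
           (ℕP.<-≤-trans i<1+t (ℕP.+-monoˡ-≤ t (ℕP.≤-trans (s≤s z≤n) (m<k*[1+m] r))))))

      durfeeSum-suc : ∀ r → durfeeSum r ≗ durfeeSum (suc r)
      durfeeSum-suc r i = ℤP.i-j≡0⇒i≡j _ _ (durfeeGap-Ord≥ (suc i) r i ℕP.≤-refl)

      durfeeSum-+ : ∀ d r → durfeeSum r ≗ durfeeSum (d ℕ.+ r)
      durfeeSum-+ zero    r i = refl
      durfeeSum-+ (suc d) r i = trans (durfeeSum-+ d r i) (durfeeSum-suc (d ℕ.+ r) i)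

      durfeeSum-low : ∀ R {i} → i < R → durfeeSum R i ≡ invPochK∞ i
      durfeeSum-low R {i} i<R = begin
        durfeeSum R i
          ≡⟨ sum∞-uncons (durfeeTerm R) (durfeeTerm-summable R) i ⟩
        durfeeTerm R 0 i + sum∞ (λ n → durfeeTerm R (suc n)) i
          ≡⟨ cong₂ _+_ first (sumTo-zero (suc i) (λ n _ → higher n)) ⟩
        invPochK∞ i + + 0
          ≡⟨ ℤP.+-identityʳ _ ⟩
        invPochK∞ i
          ∎
        where
        open ≡-Reasoning
        first : durfeeTerm R 0 i ≡ invPochK∞ i
        first = trans (shiftS-≡ (mul oneS (invPochK R)) (ℕP.*-zeroʳ k) i)
          (trans (shiftS-zero (mul oneS (invPochK R)) i) (trans (mul-identityˡ (invPochK R) i) (invPochK-stable R i<R)))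
        higher : ∀ n → durfeeTerm R (suc n) i ≡ + 0
        higher n = Ord≥-shiftS (k ℕ.* (suc n ℕ.* (suc n ℕ.+ R))) (mul (invPochK (suc n)) (invPochK (suc n ℕ.+ R)))
                               i (ℕP.<-≤-trans i<R R≤exp)
          where
          R≤exp : R ≤ k ℕ.* (suc n ℕ.* (suc n ℕ.+ R))
          R≤exp = ℕP.≤-trans (ℕP.m≤n+m R (suc n)) (ℕP.≤-trans (ℕP.m≤n*m _ (suc n)) (m≤k*m _))

      durfee : ∀ r → durfeeSum r ≗ invPochK∞
      durfee r i = trans (durfeeSum-+ (suc i) r i) (durfeeSum-low (suc i ℕ.+ r) (s≤s (ℕP.m≤m+n i r)))

module TripleProduct where

  open import Data.Integer using (_+_; _*_; -_; _-_)
  open FiniteSums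
  open PowerSeries
  open Exponents
  open EulerDurfee

  -- Σ_{r ∈ ℤ, -A < r < A} (-1)^r q^{k C(r,2) + c₁ r}; the negative indices r = -(s+1) form the second
  -- sum, whose exponent k C(-(s+1),2) - c₁(s+1) equals eulerExp k c₂ (s+1) when c₁ + c₂ = k.
  theta : ℕ → ℕ → ℕ → ℕ → Series
  theta k c₁ c₂ A = addS (sumS A (λ r → scaleS (sign r) (monoS (eulerExp k c₁ r))))
                         (sumS A (λ s → scaleS (sign (suc s)) (monoS (eulerExp k c₂ (suc s)))))

  mul-theta : ∀ k c₁ c₂ A f → mul (theta k c₁ c₂ A) f ≗
    addS (sumS A (λ r → scaleS (sign r) (shiftS (eulerExp k c₁ r) f)))
         (sumS A (λ s → scaleS (sign (suc s)) (shiftS (eulerExp k c₂ (suc s)) f)))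
  mul-theta k c₁ c₂ A f N =
    trans (mul-addSˡ (sumS A _) (sumS A _) f N) (cong₂ _+_ (termwise sign (eulerExp k c₁) N)
                                                           (termwise (λ s → sign (suc s)) (λ s → eulerExp k c₂ (suc s)) N))
    where
    termwise : ∀ (c : ℕ → ℤ) (e : ℕ → ℕ) →
      mul (sumS A (λ r → scaleS (c r) (monoS (e r)))) f ≗ sumS A (λ r → scaleS (c r) (shiftS (e r) f))
    termwise c e N = trans (mul-sumSˡ A _ f N)
      (sumS-cong A (λ r i → trans (mul-scaleSˡ (c r) (monoS (e r)) f i) (cong (c r *_) (mul-monoSˡ (e r) f i))) N)

  sumTo-collapse : ∀ A (c : ℕ → ℤ) (x : ℕ → ℕ) (G T : ℕ → ℕ → Series) (J : Series) →
    (∀ r n → T r n ≗ scaleS (c r) (shiftS (x r) (G r n))) → (∀ r → Summable (G r)) → (∀ r → sum∞ (G r) ≗ J) →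
    ∀ {N} → N < A → sumTo A (λ r → sumTo A (λ n → T r n N)) ≡ sumS A (λ r → scaleS (c r) (shiftS (x r) J)) N
  sumTo-collapse A c x G T J T≗ summable sum≗J {N} N<A = sumTo-cong A row
    where
    open ≡-Reasoning
    row : ∀ r → sumTo A (λ n → T r n N) ≡ scaleS (c r) (shiftS (x r) J) N
    row r = begin
      sumTo A (λ n → T r n N)                               ≡⟨ sumTo-cong A (λ n → T≗ r n N) ⟩
      sumS A (λ n → scaleS (c r) (shiftS (x r) (G r n))) N  ≡⟨ scaleS-sumS (c r) A (λ n → shiftS (x r) (G r n)) N ⟨
      c r * sumS A (λ n → shiftS (x r) (G r n)) N           ≡⟨ cong (c r *_) (shiftS-sumS (x r) A (G r) N) ⟨
      c r * shiftS (x r) (sumS A (G r)) N                   ≡⟨ cong (c r *_) (shiftS-cong[] (x r) truncated N ℕP.≤-refl) ⟩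
      c r * shiftS (x r) J N                                ∎
      where
      truncated : sumS A (G r) ≗[ N ] J
      truncated = ≗[]-trans (≗[]-sym (sum∞-≗[]-sumS (G r) (summable r) A N<A)) (≗⇒≗[] N (sum≗J r))

  sumTo-square-theta : ∀ k c₁ c₂ k′ → 1 ≤ k′ → (f : ℕ → ℕ → Series) →
    (∀ m n → Ord≥ m (f m n)) → (∀ m n → Ord≥ n (f m n)) →
    (∀ r n → f (n ℕ.+ r) n ≗ scaleS (sign r) (shiftS (eulerExp k c₁ r) (durfeeTerm k′ r n))) →
    (∀ s m → f m (suc m ℕ.+ s) ≗ scaleS (sign (suc s)) (shiftS (eulerExp k c₂ (suc s)) (durfeeTerm k′ (suc s) m))) →
    ∀ {N} A → N < A → sumTo A (λ m → sumTo A (λ n → f m n N)) ≡ mul (theta k c₁ c₂ A) (invPochK∞ k′) N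
  sumTo-square-theta k c₁ c₂ k′ 1≤k′ f ordˡ ordʳ diagonal antidiagonal {N} A N<A = begin
    sumTo A (λ m → sumTo A (λ n → f m n N))
      ≡⟨ sumTo-diagonals (suc N) A (λ m n → f m n N) (λ m n N<m → ordˡ m n N N<m) (λ m n N<n → ordʳ m n N N<n) N<A ⟩
    sumTo A (λ r → sumTo A (λ n → f (n ℕ.+ r) n N)) + sumTo A (λ s → sumTo A (λ m → f m (suc m ℕ.+ s) N))
      ≡⟨ cong₂ _+_ (sumTo-collapse A sign (eulerExp k c₁) (durfeeTerm k′) (λ r n → f (n ℕ.+ r) n) (invPochK∞ k′)
                      diagonal (durfeeTerm-summable k′ 1≤k′) (durfee k′ 1≤k′) N<A)
                   (sumTo-collapse A (λ s → sign (suc s)) (λ s → eulerExp k c₂ (suc s)) (λ s → durfeeTerm k′ (suc s))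
                      (λ s m → f m (suc m ℕ.+ s)) (invPochK∞ k′)
                      antidiagonal (λ s → durfeeTerm-summable k′ 1≤k′ (suc s)) (λ s → durfee k′ 1≤k′ (suc s)) N<A) ⟩
    addS (sumS A (λ r → scaleS (sign r) (shiftS (eulerExp k c₁ r) (invPochK∞ k′))))
         (sumS A (λ s → scaleS (sign (suc s)) (shiftS (eulerExp k c₂ (suc s)) (invPochK∞ k′)))) N
      ≡⟨ mul-theta k c₁ c₂ A (invPochK∞ k′) N ⟨
    mul (theta k c₁ c₂ A) (invPochK∞ k′) N
      ∎
    where open ≡-Reasoning

  eulerTerm-pair : ∀ {k} b c → b ℕ.+ c ≡ k → ∀ n p →
    mul (eulerTerm k c (n ℕ.+ p)) (eulerTerm k b n) ≗ scaleS (sign p) (shiftS (eulerExp k c p) (durfeeTerm k p n))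
  eulerTerm-pair {k} b c b+c≡k n p = begin
    mul (eulerTerm k c (n ℕ.+ p)) (eulerTerm k b n)
      ≈⟨ mul-scaleS-shiftS (sign (n ℕ.+ p)) (eulerExp k c (n ℕ.+ p)) (invPochK k (n ℕ.+ p))
                           (sign n) (eulerExp k b n) (invPochK k n) ⟩
    scaleS (sign (n ℕ.+ p) * sign n) (shiftS (eulerExp k c (n ℕ.+ p) ℕ.+ eulerExp k b n) P)
      ≈⟨ scaleS-≡ (shiftS (eulerExp k c (n ℕ.+ p) ℕ.+ eulerExp k b n) P)
                  (trans (ℤP.*-comm (sign (n ℕ.+ p)) (sign n)) (sign-offset n p)) ⟩
    scaleS (sign p) (shiftS (eulerExp k c (n ℕ.+ p) ℕ.+ eulerExp k b n) P)
      ≈⟨ scaleS-cong (sign p) (shiftS-≡ P (eulerExp-pair b c b+c≡k n p)) ⟩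
    scaleS (sign p) (shiftS (eulerExp k c p ℕ.+ d) P)
      ≈⟨ scaleS-cong (sign p) (shiftS-shiftS (eulerExp k c p) d P) ⟨
    scaleS (sign p) (shiftS (eulerExp k c p) (shiftS d P))
      ≈⟨ scaleS-cong (sign p) (shiftS-cong (eulerExp k c p) (shiftS-cong d (mul-comm (invPochK k (n ℕ.+ p)) (invPochK k n)))) ⟩
    scaleS (sign p) (shiftS (eulerExp k c p) (durfeeTerm k p n))
      ∎
    where
    open ≗-Reasoning
    d = k ℕ.* (n ℕ.* (n ℕ.+ p))
    P = mul (invPochK k (n ℕ.+ p)) (invPochK k n)

  module _ (a h : ℕ) (1≤a : 1 ≤ a) (1≤h : 1 ≤ h) where

    private
      k = a ℕ.+ h
      1≤k = ℕP.≤-trans 1≤a (ℕP.m≤m+n a h)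

    eulerSum-product-theta : ∀ {N} A → N < A →
      mul (eulerSum k h) (eulerSum k a) ≗[ N ] mul (theta k h a A) (invPochK∞ k)
    eulerSum-product-theta A N<A i i≤N =
      trans (mul-sum∞-sum∞ (eulerTerm k h) (eulerTerm k a) (summable h 1≤h) (summable a 1≤a) A i<A)
            (sumTo-square-theta k h a k 1≤k (λ m n → mul (eulerTerm k h m) (eulerTerm k a n))
              (λ m n → Ord≥-mulˡ (eulerTerm k h m) (eulerTerm k a n) (summable h 1≤h m))
              (λ m n → Ord≥-mulʳ (eulerTerm k h m) (eulerTerm k a n) (summable a 1≤a n))
              (λ r n → eulerTerm-pair a h refl n r) antidiagonal A i<A)
      where
      i<A = ℕP.≤-<-trans i≤N N<A
      summable = eulerTerm-summable k 1≤k
      antidiagonal : ∀ s m → mul (eulerTerm k h m) (eulerTerm k a (suc m ℕ.+ s))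
                           ≗ scaleS (sign (suc s)) (shiftS (eulerExp k a (suc s)) (durfeeTerm k (suc s) m))
      antidiagonal s m j = begin
        mul (eulerTerm k h m) (eulerTerm k a (suc m ℕ.+ s)) j
          ≡⟨ cong (λ l → mul (eulerTerm k h m) (eulerTerm k a l) j) (sym (ℕP.+-suc m s)) ⟩
        mul (eulerTerm k h m) (eulerTerm k a (m ℕ.+ suc s)) j
          ≡⟨ mul-comm (eulerTerm k h m) (eulerTerm k a (m ℕ.+ suc s)) j ⟩
        mul (eulerTerm k a (m ℕ.+ suc s)) (eulerTerm k h m) j
          ≡⟨ eulerTerm-pair h a (ℕP.+-comm h a) m (suc s) j ⟩
        scaleS (sign (suc s)) (shiftS (eulerExp k a (suc s)) (durfeeTerm k (suc s) m)) j
          ∎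
        where open ≡-Reasoning

    jacobiTriple : ∀ {N} A → N < A → mul (mul (pochInf a k) (pochInf h k)) (pochInf k k) ≗[ N ] theta k h a A
    jacobiTriple {N} A N<A = ≗[]-trans (mul-cong[] {g = pochInf k k} eulers (λ _ _ → refl)) (≗⇒≗[] N cancel)
      where
      eulers : mul (pochInf a k) (pochInf h k) ≗[ N ] mul (theta k h a A) (invPochK∞ k)
      eulers = ≗[]-trans (≗⇒≗[] N (λ i → trans (mul-cong (euler k 1≤k a 1≤a) (euler k 1≤k h 1≤h) i)
                                                (mul-comm (eulerSum k a) (eulerSum k h) i)))
                         (eulerSum-product-theta A N<A)
      cancel : mul (mul (theta k h a A) (invPochK∞ k)) (pochInf k k) ≗ theta k h a A
      cancel = begin
        mul (mul (theta k h a A) (invPochK∞ k)) (pochInf k k)   ≈⟨ mul-assoc (theta k h a A) (invPochK∞ k) (pochInf k k) ⟩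
        mul (theta k h a A) (mul (invPochK∞ k) (pochInf k k))   ≈⟨ mul-congˡ (theta k h a A) (invPochK∞-pochInf k 1≤k) ⟩
        mul (theta k h a A) oneS                                ≈⟨ mul-identityʳ (theta k h a A) ⟩
        theta k h a A                                           ∎
        where open ≗-Reasoning

module DoubleSum where

  open import Data.Integer using (_+_; _*_; -_; _-_)
  open import Data.Nat.DivMod using (_/_; m*n/n≡m)
  open import Data.Product using (_×_; _,_; proj₁; proj₂)
  open import Data.Sum using (inj₁; inj₂)
  open PowerSeries
  open Exponents
  open EulerDurfee
  open TripleProduct

  expo-≡ : ∀ {k j m n} X → expoNum k j m n ≡ + (X ℕ.* 2) → expo k j m n ≡ X
  expo-≡ X e = trans (cong (λ z → ℤ.∣ z ∣ / 2) e) (m*n/n≡m X 2)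

  pos-quadratic : ∀ k c t m C →
    + ((k ℕ.* C ℕ.+ c ℕ.* t ℕ.+ m ℕ.* (m ℕ.+ t)) ℕ.* 2) ≡ (+ k * + C + + c * + t + + m * (+ m + + t)) * + 2
  pos-quadratic k c t m C = trans (ℤP.pos-* (k ℕ.* C ℕ.+ c ℕ.* t ℕ.+ m ℕ.* (m ℕ.+ t)) 2)
    (cong (_* + 2) (cong₂ _+_ (cong₂ _+_ (ℤP.pos-* k C) (ℤP.pos-* c t)) (ℤP.pos-* m (m ℕ.+ t))))

  pos-choose2-double : ∀ t → + t * + t - (+ choose2 t + + choose2 t + + t) ≡ + 0
  pos-choose2-double t = begin
    + t * + t - + (choose2 t ℕ.+ choose2 t ℕ.+ t)     ≡⟨ cong (_- + (choose2 t ℕ.+ choose2 t ℕ.+ t)) (ℤP.pos-* t t) ⟨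
    + (t ℕ.* t) - + (choose2 t ℕ.+ choose2 t ℕ.+ t)  ≡⟨ cong (λ x → + (t ℕ.* t) - + x) (choose2-double t) ⟩
    + (t ℕ.* t) - + (t ℕ.* t)                        ≡⟨ ℤP.+-inverseʳ (+ (t ℕ.* t)) ⟩
    + 0                                              ∎
    where open ≡-Reasoning

  +-*-vanishing : ∀ x y {d} → d ≡ + 0 → x + y * d ≡ x
  +-*-vanishing x y refl = trans (cong (λ z → x + z) (ℤP.*-zeroʳ y)) (ℤP.+-identityʳ x)

  -- Parametrising k = a + (j + a) and h = j + a turns these into ring identities, which apply to
  -- expoNum directly since + (x ℕ.+ y) and + x + + y are definitionally equal; the last summands
  -- vanish by choose2-double.
  expoNum-diagonal : ∀ A J N R C →
    (A + (J + A)) * (N + R) * (N + R) - (+ 2 * (A + (J + A)) - + 2) * (N + R) * N + (A + (J + A)) * N * N + J * ((N + R) - N)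
      ≡ ((A + (J + A)) * C + (J + A) * R + N * (N + R)) * + 2 + (A + (J + A)) * (R * R - (C + C + R))
  expoNum-diagonal = solve-∀

  expoNum-antidiagonal : ∀ A J M T C →
    (A + (J + A)) * M * M - (+ 2 * (A + (J + A)) - + 2) * M * (M + T) + (A + (J + A)) * (M + T) * (M + T) + J * (M - (M + T))
      ≡ ((A + (J + A)) * C + A * T + M * (M + T)) * + 2 + (A + (J + A)) * (T * T - (C + C + T))
  expoNum-antidiagonal = solve-∀

  invPoch≗invPochK : ∀ n → invPoch n ≗ invPochK 1 n
  invPoch≗invPochK n = finProd-cong n (λ i N → cong (λ e → geom e N) (sym (ℕP.*-identityˡ (suc i))))

  module _ (a j : ℕ) where

    private
      h = j ℕ.+ a
      k = a ℕ.+ h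

    expo-diagonal : ∀ n r → expo k j (n ℕ.+ r) n ≡ eulerExp k h r ℕ.+ n ℕ.* (n ℕ.+ r)
    expo-diagonal n r = expo-≡ {k} {j} {n ℕ.+ r} {n} (eulerExp k h r ℕ.+ n ℕ.* (n ℕ.+ r)) (begin
      expoNum k j (n ℕ.+ r) n
        ≡⟨ expoNum-diagonal (+ a) (+ j) (+ n) (+ r) (+ choose2 r) ⟩
      (+ k * + choose2 r + + h * + r + + n * (+ n + + r)) * + 2 + + k * (+ r * + r - (+ choose2 r + + choose2 r + + r))
        ≡⟨ +-*-vanishing _ (+ k) (pos-choose2-double r) ⟩
      (+ k * + choose2 r + + h * + r + + n * (+ n + + r)) * + 2
        ≡⟨ pos-quadratic k h r n (choose2 r) ⟨
      + ((eulerExp k h r ℕ.+ n ℕ.* (n ℕ.+ r)) ℕ.* 2)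
        ∎)
      where open ≡-Reasoning

    expo-antidiagonal : ∀ m t → expo k j m (m ℕ.+ t) ≡ eulerExp k a t ℕ.+ m ℕ.* (m ℕ.+ t)
    expo-antidiagonal m t = expo-≡ {k} {j} {m} {m ℕ.+ t} (eulerExp k a t ℕ.+ m ℕ.* (m ℕ.+ t)) (begin
      expoNum k j m (m ℕ.+ t)
        ≡⟨ expoNum-antidiagonal (+ a) (+ j) (+ m) (+ t) (+ choose2 t) ⟩
      (+ k * + choose2 t + + a * + t + + m * (+ m + + t)) * + 2 + + k * (+ t * + t - (+ choose2 t + + choose2 t + + t))
        ≡⟨ +-*-vanishing _ (+ k) (pos-choose2-double t) ⟩
      (+ k * + choose2 t + + a * + t + + m * (+ m + + t)) * + 2
        ≡⟨ pos-quadratic k a t m (choose2 t) ⟨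
      + ((eulerExp k a t ℕ.+ m ℕ.* (m ℕ.+ t)) ℕ.* 2)
        ∎)
      where open ≡-Reasoning

    quadratic-bound : ∀ c → 1 ≤ c → ∀ n r → n ℕ.+ r ≤ eulerExp k c r ℕ.+ n ℕ.* (n ℕ.+ r)
    quadratic-bound c 1≤c zero    r = ℕP.≤-trans (ℕP.m≤n*m r c {{ℕ.>-nonZero 1≤c}})
                                        (ℕP.≤-trans (ℕP.m≤n+m (c ℕ.* r) _) (ℕP.m≤m+n _ 0))
    quadratic-bound c 1≤c (suc n) r = ℕP.≤-trans (ℕP.m≤n*m (suc n ℕ.+ r) (suc n)) (ℕP.m≤n+m _ _)

    term-Ord≥ : ∀ m n → Ord≥ (expo k j m n) (term k j m n)
    term-Ord≥ m n = Ord≥-scaleS (sgn m n) _ (Ord≥-shiftS (expo k j m n) (mul (invPoch m) (invPoch n)))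

    term-≗ : ∀ m n {σ} x y Q → sgn m n ≡ σ → expo k j m n ≡ x ℕ.+ y → mul (invPoch m) (invPoch n) ≗ Q →
      term k j m n ≗ scaleS σ (shiftS x (shiftS y Q))
    term-≗ m n x y Q refl e P≗Q = scaleS-cong (sgn m n) (begin
      shiftS (expo k j m n) P  ≈⟨ shiftS-≡ P e ⟩
      shiftS (x ℕ.+ y) P       ≈⟨ shiftS-shiftS x y P ⟨
      shiftS x (shiftS y P)    ≈⟨ shiftS-cong x (shiftS-cong y P≗Q) ⟩
      shiftS x (shiftS y Q)    ∎)
      where
      open ≗-Reasoning
      P = mul (invPoch m) (invPoch n)

    module _ (1≤a : 1 ≤ a) where

      private
        1≤h = ℕP.≤-trans 1≤a (ℕP.m≤n+m a j)

      expo-≥ : ∀ m n → m ≤ expo k j m n × n ≤ expo k j m n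
      expo-≥ m n with ℕP.≤-total n m
      ... | inj₁ n≤m = m≤expo , ℕP.≤-trans n≤m m≤expo
        where
        m≤expo : m ≤ expo k j m n
        m≤expo = subst (λ x → x ≤ expo k j x n) (ℕP.m+[n∸m]≡n n≤m)
          (subst (n ℕ.+ (m ∸ n) ≤_) (sym (expo-diagonal n (m ∸ n))) (quadratic-bound h 1≤h n (m ∸ n)))
      ... | inj₂ m≤n = ℕP.≤-trans m≤n n≤expo , n≤expo
        where
        n≤expo : n ≤ expo k j m n
        n≤expo = subst (λ x → x ≤ expo k j m x) (ℕP.m+[n∸m]≡n m≤n)
          (subst (m ℕ.+ (n ∸ m) ≤_) (sym (expo-antidiagonal m (n ∸ m))) (quadratic-bound a 1≤a m (n ∸ m)))

      term-diagonal : ∀ r n → term k j (n ℕ.+ r) n ≗ scaleS (sign r) (shiftS (eulerExp k h r) (durfeeTerm 1 r n))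
      term-diagonal r n =
        term-≗ (n ℕ.+ r) n (eulerExp k h r) (1 ℕ.* (n ℕ.* (n ℕ.+ r))) (mul (invPochK 1 n) (invPochK 1 (n ℕ.+ r)))
        (trans (sign-+ (n ℕ.+ r) n) (trans (ℤP.*-comm (sign (n ℕ.+ r)) (sign n)) (sign-offset n r)))
        (trans (expo-diagonal n r) (cong (eulerExp k h r ℕ.+_) (sym (ℕP.*-identityˡ (n ℕ.* (n ℕ.+ r))))))
        (λ i → trans (mul-cong (invPoch≗invPochK (n ℕ.+ r)) (invPoch≗invPochK n) i)
                     (mul-comm (invPochK 1 (n ℕ.+ r)) (invPochK 1 n) i))

      term-antidiagonal : ∀ s m →
        term k j m (suc m ℕ.+ s) ≗ scaleS (sign (suc s)) (shiftS (eulerExp k a (suc s)) (durfeeTerm 1 (suc s) m))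
      term-antidiagonal s m i = trans (cong (λ n → term k j m n i) (sym (ℕP.+-suc m s)))
        (term-≗ m (m ℕ.+ suc s) (eulerExp k a (suc s)) (1 ℕ.* (m ℕ.* (m ℕ.+ suc s)))
                (mul (invPochK 1 m) (invPochK 1 (m ℕ.+ suc s)))
        (trans (sign-+ m (m ℕ.+ suc s)) (sign-offset m (suc s)))
        (trans (expo-antidiagonal m (suc s)) (cong (eulerExp k a (suc s) ℕ.+_) (sym (ℕP.*-identityˡ (m ℕ.* (m ℕ.+ suc s))))))
        (mul-cong (invPoch≗invPochK m) (invPoch≗invPochK (m ℕ.+ suc s))) i)

      lhsPartial-theta : ∀ {N} M → N < M → lhsPartial k j M N ≡ mul (theta k h a M) (invPochK∞ 1) N
      lhsPartial-theta M N<M = sumTo-square-theta k h a 1 ℕP.≤-refl (term k j)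
        (λ m n → Ord≥-weaken (proj₁ (expo-≥ m n)) (term-Ord≥ m n))
        (λ m n → Ord≥-weaken (proj₂ (expo-≥ m n)) (term-Ord≥ m n))
        term-diagonal term-antidiagonal M N<M

      rhs-theta : ∀ {N} M → N < M → rhs k j N ≡ mul (theta k h a M) (invPochK∞ 1) N
      rhs-theta {N} M N<M = begin
        rhs k j N
          ≡⟨ cong₂ (λ x y → mul (mul (mul (pochInf x k) (pochInf y k)) (pochInf k k)) invPochInf N) [k-j]/2≡a [k+j]/2≡h ⟩
        mul (mul (mul (pochInf a k) (pochInf h k)) (pochInf k k)) invPochInf N
          ≡⟨ mul-cong[] (jacobiTriple a h 1≤a 1≤h M N<M) (λ i _ → invPoch≗invPochK (suc i) i) N ℕP.≤-refl ⟩
        mul (theta k h a M) (invPochK∞ 1) N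
          ∎
        where
        open ≡-Reasoning
        [k-j]/2≡a : (k ∸ j) / 2 ≡ a
        [k-j]/2≡a = trans (cong (λ x → (x ∸ j) / 2) (ring a j))
                          (trans (cong (_/ 2) (ℕP.m+n∸m≡n j (a ℕ.* 2))) (m*n/n≡m a 2))
          where
          ring : ∀ a j → a ℕ.+ (j ℕ.+ a) ≡ j ℕ.+ a ℕ.* 2
          ring = ℕ-Ring.solve-∀
        [k+j]/2≡h : (k ℕ.+ j) / 2 ≡ h
        [k+j]/2≡h = trans (cong (_/ 2) (ring a j)) (m*n/n≡m h 2)
          where
          ring : ∀ a j → a ℕ.+ (j ℕ.+ a) ℕ.+ j ≡ (j ℕ.+ a) ℕ.* 2
          ring = ℕ-Ring.solve-∀

open import Data.Nat using (_+_)
open import Data.Nat.Divisibility using (_∣_; divides)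
open import Data.Product using (∃-syntax; _×_; _,_)
open DoubleSum

k≡a+[j+a] : ∀ {k j} → j < k → 2 ∣ (j + k) → ∃[ a ] (1 ≤ a × a + (j + a) ≡ k)
k≡a+[j+a] {k} {j} j<k (divides q j+k≡q*2) = q ∸ j , ℕP.m<n⇒0<n∸m j<q , ℕP.+-cancelˡ-≡ j _ k (begin
  j + (q ∸ j + (j + (q ∸ j)))   ≡⟨ cong (λ x → j + (q ∸ j + x)) j+[q∸j]≡q ⟩
  j + (q ∸ j + q)               ≡⟨ ℕP.+-assoc j (q ∸ j) q ⟨
  j + (q ∸ j) + q               ≡⟨ cong (_+ q) j+[q∸j]≡q ⟩
  q + q                         ≡⟨ double q ⟨
  q ℕ.* 2                       ≡⟨ j+k≡q*2 ⟨
  j + k                         ∎)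
  where
  open ≡-Reasoning
  double : ∀ x → x ℕ.* 2 ≡ x + x
  double = ℕ-Ring.solve-∀
  j<q : j < q
  j<q = ℕP.*-cancelʳ-< 2 j q (subst₂ _<_ (sym (double j)) j+k≡q*2 (ℕP.+-monoʳ-< j j<k))
  j+[q∸j]≡q : j + (q ∸ j) ≡ q
  j+[q∸j]≡q = ℕP.m+[n∸m]≡n (ℕP.<⇒≤ j<q)

corollary12 : (k j : ℕ) → 1 ≤ k → j < k → 2 ∣ (j + k) →
    (N : ℕ) → ∃[ M ] ((M′ : ℕ) → M ≤ M′ → lhsPartial k j M′ N ≡ rhs k j N)
-- 1 ≤ k is implied by j < k.
corollary12 k j _ j<k 2∣j+k N with k≡a+[j+a] j<k 2∣j+k
... | a , 1≤a , refl = suc N , λ M N<M →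
  trans (lhsPartial-theta a j 1≤a M N<M) (sym (rhs-theta a j 1≤a M N<M))
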